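{- Let $K$ be a model of $\mathrm{VFA}$. The following are equivalent: (1) $K$ is transformally Henselian; (2) $K$ and all of its Frobenius twists satisfy: whenever $f\in\mathcal O[x]_\sigma$ and $a\in\mathcal O$ satisfy $vf(a)>2\,vf'(a)$, there is $b\in\mathcal O$ with $f(b)=0$ and $v(a-b)=vf(a)-vf'(a)$. In case (2) the element $b$ is uniquely determined subject to $v(a-b)\ge vf(a)-vf'(a)$. Furthermore, if $K$ is merely assumed algebraically Henselian, then for $f\in\mathcal O[x]_\sigma$ and $a\in\mathcal O$ with $vf(a)>2\,vf'(a)$ there is at least some $b\in\mathcal O$ with $vf(b)-vf(a)\ge\sigma\big(vf(a)-vf'(a)\big)$ and $v(a-b)=vf(a)-vf'(a)$.
   Context: All valued fields have equal characteristic exponent $p$; $\phi(x)=x^p$. A model of $\mathrm{VFA}$ is a perfect valued field $K$ (valuation $v$, valuation ring $\mathcal O$, maximal ideal $\mathcal M$, value group $\Gamma$) with an automorphism $\sigma$ such that $\sigma^{ -1}(\mathcal O)=\mathcal O$, $\sigma^{ -1}(\mathcal M)=\mathcal M$ and $n\alpha<\sigma\alpha$ for $0<\alpha\in\Gamma$, $n\in\mathbf N$. Frobenius twists: $(K,\sigma\circ\phi^m)$, $m\in\mathbf Z$. $\mathcal O[x]_\sigma$: polynomials with coefficients in $\mathcal O$ in the variables $x,x^\sigma,x^{\sigma^2},\dots$; $f(x+\varepsilon)=\sum_{\nu\in\mathbf N[\sigma]}f_\nu(x)\varepsilon^\nu$, $f'=f_1$. $K$ is transformally Henselian if $K$ and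 all Frobenius twists satisfy: for $f\in\mathcal O[x]_\sigma$, $a\in\mathcal O$ with $vf(a)>0$, $vf'(a)=0$, some $b\in\mathcal O$ has $f(b)=0$ and the residue class of $a$. Algebraically Henselian means Henselian as a valued field. -}

module Defs where

open import Level using (Level; _⊔_) renaming (suc to lsuc)
open import Algebra.Bundles using (CommutativeRing; AbelianGroup)
open import Relation.Binary.Core using (Rel)
open import Relation.Binary.Structures using (IsTotalOrder)
open import Relation.Nullary using (¬_)
open import Relation.Binary.PropositionalEquality using (_≡_)
open import Data.Nat using (ℕ; zero; suc)
open import Data.Nat.Primality using (Prime)
open import Data.Integer using (ℤ; +_; -[1+_])
open import Data.Product using (Σ; _×_; _,_; proj₁)
open import Data.Sum using (_⊎_)
open import Data.Unit.Polymorphic using (⊤)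

-- Ordered abelian groups (written additively: _∙_, ε, _⁻¹)

record OrderedAbelianGroup (g ℓ : Level) : Set (lsuc (g ⊔ ℓ)) where
  field
    abelianGroup : AbelianGroup g ℓ
  open AbelianGroup abelianGroup public
  field
    _≤_          : Rel Carrier ℓ
    isTotalOrder : IsTotalOrder _≈_ _≤_
    ≤-compat     : ∀ {x y} z → x ≤ y → (x ∙ z) ≤ (y ∙ z)

  infix 4 _<_
  infixr 8 _·_
  _<_ : Rel Carrier ℓ
  x < y = (x ≤ y) × ¬ (x ≈ y)

  _·_ : ℕ → Carrier → Carrier
  zero  · x = ε
  suc n · x = x ∙ (n · x)

module WithInfinity {g ℓ} (G : OrderedAbelianGroup g ℓ) where
  open OrderedAbelianGroup G

  infix 4 _≈∞_ _≤∞_ _<∞_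
  infixl 6 _+∞_ _⊖_

  data Γ∞ : Set g where
    fin : Carrier → Γ∞
    ∞   : Γ∞

  data _≈∞_ : Γ∞ → Γ∞ → Set (g ⊔ ℓ) where
    fin≈ : ∀ {x y} → x ≈ y → fin x ≈∞ fin y
    ∞≈∞  : ∞ ≈∞ ∞

  data _≤∞_ : Γ∞ → Γ∞ → Set (g ⊔ ℓ) where
    fin≤ : ∀ {x y} → x ≤ y → fin x ≤∞ fin y
    ≤top : ∀ {x} → x ≤∞ ∞

  _<∞_ : Γ∞ → Γ∞ → Set (g ⊔ ℓ)
  x <∞ y = (x ≤∞ y) × ¬ (x ≈∞ y)

  _+∞_ : Γ∞ → Γ∞ → Γ∞
  fin x +∞ fin y = fin (x ∙ y)
  fin x +∞ ∞     = ∞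
  ∞     +∞ _     = ∞

  _⊖_ : Γ∞ → Carrier → Γ∞
  fin x ⊖ δ = fin (x ∙ (δ ⁻¹))
  ∞     ⊖ δ = ∞

record ValuedField (c ℓ g ℓg : Level) : Set (lsuc (c ⊔ ℓ ⊔ g ⊔ ℓg)) where
  field
    K-ring : CommutativeRing c ℓ
    Γ    : OrderedAbelianGroup g ℓg
  open CommutativeRing K-ring public
  module Γ = OrderedAbelianGroup Γ
  open WithInfinity Γ public
  field
    1≉0      : ¬ (1# ≈ 0#)
    inverse  : ∀ x → ¬ (x ≈ 0#) → Σ Carrier (λ y → (x * y) ≈ 1#)
    v        : Carrier → Γ∞
    v-cong   : ∀ {x y} → x ≈ y → v x ≈∞ v y
    v-∞⇒0    : ∀ x → v x ≈∞ ∞ → x ≈ 0#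
    v-0      : v 0# ≈∞ ∞
    v-*      : ∀ x y → v (x * y) ≈∞ (v x +∞ v y)
    v-+      : ∀ x y γ → γ ≤∞ v x → γ ≤∞ v y → γ ≤∞ v (x + y)
    v-onto   : ∀ γ → Σ Carrier (λ x → v x ≈∞ fin γ)

  _∈𝒪 : Carrier → Set (g ⊔ ℓg)
  x ∈𝒪 = fin Γ.ε ≤∞ v x

  _∈ℳ : Carrier → Set (g ⊔ ℓg)
  x ∈ℳ = fin Γ.ε <∞ v x

  infixr 8 _^_
  ι : ℕ → Carrier
  ι zero    = 0#
  ι (suc n) = 1# + ι n

  _^_ : Carrier → ℕ → Carrier
  x ^ zero  = 1#
  x ^ suc n = x * (x ^ n)

  -- Difference polynomials: terms in variables x, x^τ, x^(τ²), …
  -- (var i stands for x^(τ^i)); the same syntax serves 𝒪[x]_τ for any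
  -- automorphism τ, which is supplied at evaluation time.

  data DPoly : Set c where
    con  : Carrier → DPoly
    var  : ℕ → DPoly
    _⊕_  : DPoly → DPoly → DPoly
    _⊗_  : DPoly → DPoly → DPoly

  CoeffsIn𝒪 : DPoly → Set (g ⊔ ℓg)
  CoeffsIn𝒪 (con a) = a ∈𝒪
  CoeffsIn𝒪 (var i) = ⊤
  CoeffsIn𝒪 (f ⊕ h) = CoeffsIn𝒪 f × CoeffsIn𝒪 h
  CoeffsIn𝒪 (f ⊗ h) = CoeffsIn𝒪 f × CoeffsIn𝒪 h

  Algebraic : DPoly → Set
  Algebraic (con a) = Data.Unit.⊤
    where import Data.Unit
  Algebraic (var i) = i ≡ 0
  Algebraic (f ⊕ h) = Algebraic f × Algebraic h
  Algebraic (f ⊗ h) = Algebraic f × Algebraic h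

  iter : (Carrier → Carrier) → ℕ → Carrier → Carrier
  iter τ zero    a = a
  iter τ (suc n) a = τ (iter τ n a)

  eval : (Carrier → Carrier) → DPoly → Carrier → Carrier
  eval τ (con a) b = a
  eval τ (var i) b = iter τ i b
  eval τ (f ⊕ h) b = eval τ f b + eval τ h b
  eval τ (f ⊗ h) b = eval τ f b * eval τ h b

  -- f' = f_1 : the coefficient of ε in f(x+ε), i.e. ∂f/∂x
  deriv : DPoly → DPoly
  deriv (con a)       = con 0#
  deriv (var zero)    = con 1#
  deriv (var (suc i)) = con 0#
  deriv (f ⊕ h)       = deriv f ⊕ deriv h
  deriv (f ⊗ h)       = (deriv f ⊗ h) ⊕ (f ⊗ deriv h)

record VFA (p : ℕ) {c ℓ g ℓg} (K : ValuedField c ℓ g ℓg)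
       : Set (c ⊔ ℓ ⊔ g ⊔ ℓg) where
  open ValuedField K
  field
    -- equal characteristic exponent p
    charExp  : (p ≡ 1 × (∀ n → v (ι (suc n)) ≈∞ fin Γ.ε))
               ⊎ (Prime p × ι p ≈ 0#)
    perfect  : ∀ x → Σ Carrier (λ y → (y ^ p) ≈ x)
    σ        : Carrier → Carrier
    σ-cong   : ∀ {x y} → x ≈ y → σ x ≈ σ y
    σ-+      : ∀ x y → σ (x + y) ≈ (σ x + σ y)
    σ-*      : ∀ x y → σ (x * y) ≈ (σ x * σ y)
    σ-1      : σ 1# ≈ 1#
    σ-onto   : ∀ y → Σ Carrier (λ x → σ x ≈ y)
    σ-𝒪      : ∀ x → (x ∈𝒪 → σ x ∈𝒪) × (σ x ∈𝒪 → x ∈𝒪)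
    σ-ℳ      : ∀ x → (x ∈ℳ → σ x ∈ℳ) × (σ x ∈ℳ → x ∈ℳ)
    -- n α < σ α for 0 < α ∈ Γ  (σ α = v(σ x) when α = v x)
    σ-growth : ∀ x α (n : ℕ) → v x ≈∞ fin α → Γ._<_ Γ.ε α →
               fin (n Γ.· α) <∞ v (σ x)

  φ : Carrier → Carrier
  φ x = x ^ p

  φ⁻¹ : Carrier → Carrier
  φ⁻¹ x = proj₁ (perfect x)

  φ^ : ℤ → Carrier → Carrier
  φ^ (+ n)    = iter φ n
  φ^ -[1+ n ] = iter φ⁻¹ (suc n)

  twist : ℤ → Carrier → Carrier
  twist m x = σ (φ^ m x)

  σ∞ : Γ∞ → Γ∞
  σ∞ (fin γ) = v (σ (proj₁ (v-onto γ)))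
  σ∞ ∞       = ∞

  THenselFor : (Carrier → Carrier) → Set (c ⊔ ℓ ⊔ g ⊔ ℓg)
  THenselFor τ = ∀ f a → CoeffsIn𝒪 f → a ∈𝒪 →
    fin Γ.ε <∞ v (eval τ f a) → v (eval τ (deriv f) a) ≈∞ fin Γ.ε →
    Σ Carrier (λ b → b ∈𝒪 × eval τ f b ≈ 0# × (b - a) ∈ℳ)

  TransformallyHenselian : Set (c ⊔ ℓ ⊔ g ⊔ ℓg)
  TransformallyHenselian = ∀ m → THenselFor (twist m)

  AlgebraicallyHenselian : Set (c ⊔ ℓ ⊔ g ⊔ ℓg)
  AlgebraicallyHenselian = ∀ f a → Algebraic f → CoeffsIn𝒪 f → a ∈𝒪 →
    fin Γ.ε <∞ v (eval σ f a) → v (eval σ (deriv f) a) ≈∞ fin Γ.ε →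
    Σ Carrier (λ b → b ∈𝒪 × eval σ f b ≈ 0# × (b - a) ∈ℳ)

  -- condition (2) for (K, τ); δ = v f'(a) (necessarily finite)
  Newton : (Carrier → Carrier) → Set (c ⊔ ℓ ⊔ g ⊔ ℓg)
  Newton τ = ∀ f a δ → CoeffsIn𝒪 f → a ∈𝒪 →
    v (eval τ (deriv f) a) ≈∞ fin δ → fin (δ Γ.∙ δ) <∞ v (eval τ f a) →
    Σ Carrier (λ b → b ∈𝒪 × eval τ f b ≈ 0# ×
                     v (a - b) ≈∞ (v (eval τ f a) ⊖ δ))

  NewtonUnique : (Carrier → Carrier) → Set (c ⊔ ℓ ⊔ g ⊔ ℓg)
  NewtonUnique τ = ∀ f a δ b b′ → CoeffsIn𝒪 f → a ∈𝒪 →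
    v (eval τ (deriv f) a) ≈∞ fin δ → fin (δ Γ.∙ δ) <∞ v (eval τ f a) →
    b ∈𝒪 → b′ ∈𝒪 → eval τ f b ≈ 0# → eval τ f b′ ≈ 0# →
    (v (eval τ f a) ⊖ δ) ≤∞ v (a - b) → (v (eval τ f a) ⊖ δ) ≤∞ v (a - b′) →
    b ≈ b′

  ApproxNewton : Set (c ⊔ g ⊔ ℓg)
  ApproxNewton = ∀ f a δ → CoeffsIn𝒪 f → a ∈𝒪 →
    v (eval σ (deriv f) a) ≈∞ fin δ → fin (δ Γ.∙ δ) <∞ v (eval σ f a) →
    Σ Carrier (λ b → b ∈𝒪 ×
      (v (eval σ f a) +∞ σ∞ (v (eval σ f a) ⊖ δ)) ≤∞ v (eval σ f b) ×
      v (a - b) ≈∞ (v (eval σ f a) ⊖ δ))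

-- The Frobenius twists τ = σ ∘ φᵐ are ring endomorphisms preserving 𝒪 with
-- v(τ x) ≥ 2 v(x) on ℳ, and this is all the Newton lemmas need. With
-- γ = v f(a) − v f′(a) > v f′(a) and v c = γ, Taylor expansion gives
-- f(a + c y) = c f′(a) (u + y + e R(y)) with v u = 0, v e > 0 and R over 𝒪, since
-- every term beyond the linear one is divisible by c² (τʲ(c)/c² ∈ 𝒪). Hensel's lemma
-- at y = −u then yields the root b = a + c y; conversely Hensel is the case
-- v f′(a) = 0. Two roots at distance μ > v f′(b) cannot coexist, since
-- f(b′) − f(b) = f′(b)(b′ − b) + O(2μ). If only ordinary polynomials have Hensel
-- roots, freeze the transformal variables of f at a and take a Newton root b₁, then
-- freeze at b₁ and take a Newton root b₂: σ moves b₂ − b₁ so far into ℳ that the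
-- frozen terms change f(b₂) by at least v f(a) + σ γ.

module Submission where

open import Defs
open import Data.Nat using (ℕ)
open import Data.Product using (_×_)

open import Level using (_⊔_)
open import Algebra.Bundles using (CommutativeRing)
import Algebra.Properties.Group as GroupProperties
import Algebra.Properties.Ring as RingProperties
import Algebra.Properties.Semiring.Exp as ExpProperties
import Algebra.Properties.Semiring.Mult as MultProperties
import Algebra.Properties.Monoid.Sum as SumProperties
import Algebra.Properties.CommutativeSemiring.Binomial as Binomial
import Algebra.Solver.Ring.NaturalCoefficients.Default as RingSolver
open import Data.Nat as ℕ using (zero; suc; _∸_; _!; s≤s; z≤n; NonZero; nonTrivial⇒n>1)
open import Data.Nat.Primality using (Prime; prime⇒nonTrivial; euclidsLemma)
open import Data.Nat.Divisibility using (_∣_; divides; ∣⇒≤; m∣m*n)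
open import Data.Nat.Combinatorics using (_C_; nCn≡1; nCk≡n!/k![n-k]!; k![n∸k]!∣n!)
open import Data.Nat.DivMod using (m/n*n≡m)
import Data.Nat.Properties as ℕₚ
open ℕₚ using (_!*_!≢0)
open import Data.Fin as Fin using (Fin; toℕ; fromℕ; inject₁)
open import Data.Fin.Properties using (toℕ-fromℕ; toℕ-inject₁; toℕ<n)
open import Data.Integer using (+_; -[1+_])
open import Data.Product using (Σ; _,_; proj₁; proj₂)
open import Data.Sum using (_⊎_; inj₁; inj₂)
open import Data.Empty using (⊥-elim)
open import Data.Unit using (⊤; tt)
open import Relation.Nullary using (¬_)
open import Relation.Binary.Core using (Rel)
open import Relation.Binary.Structures using (IsPartialOrder; IsTotalOrder)
import Relation.Binary.Construct.NonStrictToStrict as NonStrictToStrict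
import Relation.Binary.PropositionalEquality as ≡

module StrictOrderProperties {a ℓ₁ ℓ₂} {A : Set a} {_≈_ : Rel A ℓ₁} {_≤_ : Rel A ℓ₂}
                             (isPartialOrder : IsPartialOrder _≈_ _≤_) where
  open IsPartialOrder isPartialOrder
  open NonStrictToStrict _≈_ _≤_ public using (_<_; <⇒≤)
  private module S = NonStrictToStrict _≈_ _≤_

  <-≤-trans : ∀ {x y z} → x < y → y ≤ z → x < z
  <-≤-trans = S.<-≤-trans Eq.sym trans antisym ≤-respʳ-≈

  ≤-<-trans : ∀ {x y z} → x ≤ y → y < z → x < z
  ≤-<-trans = S.≤-<-trans trans antisym ≤-respˡ-≈

  <-respˡ-≈ : ∀ {x y z} → x ≈ y → x < z → y < z
  <-respˡ-≈ = S.<-respˡ-≈ Eq.trans ≤-respˡ-≈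

  <-respʳ-≈ : ∀ {x y z} → y ≈ z → x < y → x < z
  <-respʳ-≈ = S.<-respʳ-≈ Eq.sym Eq.trans ≤-respʳ-≈

module OrderedAbelianGroupProperties {g ℓ} (G : OrderedAbelianGroup g ℓ) where
  open OrderedAbelianGroup G
  open IsTotalOrder isTotalOrder public
    using (antisym; total; ≤-respˡ-≈; ≤-respʳ-≈)
    renaming (refl to ≤-refl; trans to ≤-trans; reflexive to ≤-reflexive)
  open StrictOrderProperties (IsTotalOrder.isPartialOrder isTotalOrder) public
    using (<⇒≤; <-≤-trans; ≤-<-trans; <-respˡ-≈; <-respʳ-≈)
  open GroupProperties group public using (//-rightDividesˡ; //-rightDividesʳ; ε⁻¹≈ε; inverseʳ-unique)

  ∙-monoʳ-≤ : ∀ {x y} z → x ≤ y → (z ∙ x) ≤ (z ∙ y)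
  ∙-monoʳ-≤ {x} {y} z h = ≤-respʳ-≈ (comm y z) (≤-respˡ-≈ (comm x z) (≤-compat z h))

  ∙-mono-≤ : ∀ {x y z w} → x ≤ y → z ≤ w → (x ∙ z) ≤ (y ∙ w)
  ∙-mono-≤ {y = y} {z = z} h₁ h₂ = ≤-trans (≤-compat z h₁) (∙-monoʳ-≤ y h₂)

  ∙-cancelʳ-≤ : ∀ {x y} z → (x ∙ z) ≤ (y ∙ z) → x ≤ y
  ∙-cancelʳ-≤ {x} {y} z h =
    ≤-respʳ-≈ (//-rightDividesʳ z y) (≤-respˡ-≈ (//-rightDividesʳ z x) (≤-compat (z ⁻¹) h))

  ∙-cancelʳ : ∀ {x y} z → (x ∙ z) ≈ (y ∙ z) → x ≈ y
  ∙-cancelʳ {x} {y} z h = trans (sym (//-rightDividesʳ z x)) (trans (∙-congʳ h) (//-rightDividesʳ z y))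

  ∙-mono-<-≤ : ∀ {x y z w} → x < y → z ≤ w → (x ∙ z) < (y ∙ w)
  ∙-mono-<-≤ {y = y} {z} (h₁ , x≉y) h₂ = ∙-mono-≤ h₁ h₂ , λ e →
    x≉y (antisym h₁ (∙-cancelʳ-≤ z (≤-trans (∙-monoʳ-≤ y h₂) (≤-reflexive (sym e)))))

  ∙-mono-≤-< : ∀ {x y z w} → x ≤ y → z < w → (x ∙ z) < (y ∙ w)
  ∙-mono-≤-< {x} {y} {z} {w} h₁ h₂ =
    <-respˡ-≈ (comm z x) (<-respʳ-≈ (comm w y) (∙-mono-<-≤ h₂ h₁))

  x≤y⇒ε≤y∙x⁻¹ : ∀ {x y} → x ≤ y → ε ≤ (y ∙ x ⁻¹)
  x≤y⇒ε≤y∙x⁻¹ {x} h = ≤-respˡ-≈ (inverseʳ x) (≤-compat (x ⁻¹) h)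

  x<y⇒ε<y∙x⁻¹ : ∀ {x y} → x < y → ε < (y ∙ x ⁻¹)
  x<y⇒ε<y∙x⁻¹ {x} {y} (h , x≉y) = x≤y⇒ε≤y∙x⁻¹ h , λ e →
    x≉y (sym (∙-cancelʳ (x ⁻¹) (trans (sym e) (sym (inverseʳ x)))))

  x∙y<z⇒x<z∙y⁻¹ : ∀ {x y z} → (x ∙ y) < z → x < (z ∙ y ⁻¹)
  x∙y<z⇒x<z∙y⁻¹ {x} {y} x∙y<z = <-respˡ-≈ (//-rightDividesʳ y x) (∙-mono-<-≤ x∙y<z (≤-refl {y ⁻¹}))

  ε≤x⇒y≤x∙y : ∀ {x y} → ε ≤ x → y ≤ (x ∙ y)
  ε≤x⇒y≤x∙y {y = y} h = ≤-respˡ-≈ (identityˡ y) (≤-compat y h)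

  x∙x≈ε⇒x≈ε : ∀ {x} → (x ∙ x) ≈ ε → x ≈ ε
  x∙x≈ε⇒x≈ε {x} e with total x ε
  ... | inj₁ x≤ε = antisym x≤ε (≤-respˡ-≈ e (≤-respʳ-≈ (identityˡ x) (≤-compat x x≤ε)))
  ... | inj₂ ε≤x = antisym (≤-respʳ-≈ e (≤-respˡ-≈ (identityˡ x) (≤-compat x ε≤x))) ε≤x

  ·-cong : ∀ n {x y} → x ≈ y → (n · x) ≈ (n · y)
  ·-cong zero    e = refl
  ·-cong (suc n) e = ∙-cong e (·-cong n e)

  ·-homo-+ : ∀ m n x → ((m ℕ.+ n) · x) ≈ ((m · x) ∙ (n · x))
  ·-homo-+ zero    n x = sym (identityˡ _)
  ·-homo-+ (suc m) n x = trans (∙-congˡ (·-homo-+ m n x)) (sym (assoc _ _ _))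

  ·-homo-* : ∀ m n x → ((m ℕ.* n) · x) ≈ (m · (n · x))
  ·-homo-* zero    n x = refl
  ·-homo-* (suc m) n x = trans (·-homo-+ n (m ℕ.* n) x) (∙-congˡ (·-homo-* m n x))

  n·ε≈ε : ∀ n → (n · ε) ≈ ε
  n·ε≈ε zero    = refl
  n·ε≈ε (suc n) = trans (identityˡ _) (n·ε≈ε n)

  2·x≈x∙x : ∀ x → (2 · x) ≈ (x ∙ x)
  2·x≈x∙x x = ∙-congˡ (identityʳ x)

  ε≤x⇒ε≤n·x : ∀ n {x} → ε ≤ x → ε ≤ (n · x)
  ε≤x⇒ε≤n·x zero    h = ≤-refl
  ε≤x⇒ε≤n·x (suc n) h = ≤-respˡ-≈ (identityʳ ε) (∙-mono-≤ h (ε≤x⇒ε≤n·x n h))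

  ε≤x⇒x≤[1+n]·x : ∀ n {x} → ε ≤ x → x ≤ (suc n · x)
  ε≤x⇒x≤[1+n]·x n {x} h = ≤-respˡ-≈ (identityʳ x) (∙-monoʳ-≤ x (ε≤x⇒ε≤n·x n h))

  x≤ε⇒[1+n]·x≤x : ∀ n {x} → x ≤ ε → (suc n · x) ≤ x
  x≤ε⇒[1+n]·x≤x zero    {x} h = ≤-reflexive (identityʳ x)
  x≤ε⇒[1+n]·x≤x (suc n) {x} h =
    ≤-respʳ-≈ (identityʳ x) (∙-monoʳ-≤ x (≤-trans (x≤ε⇒[1+n]·x≤x n h) h))

module ExtendedValueProperties {g ℓ} (G : OrderedAbelianGroup g ℓ) where
  open OrderedAbelianGroup G
  open WithInfinity G
  open OrderedAbelianGroupProperties G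

  ≈∞-refl : ∀ {x} → x ≈∞ x
  ≈∞-refl {fin x} = fin≈ refl
  ≈∞-refl {∞}     = ∞≈∞

  ≈∞-sym : ∀ {x y} → x ≈∞ y → y ≈∞ x
  ≈∞-sym (fin≈ e) = fin≈ (sym e)
  ≈∞-sym ∞≈∞      = ∞≈∞

  ≈∞-trans : ∀ {x y z} → x ≈∞ y → y ≈∞ z → x ≈∞ z
  ≈∞-trans (fin≈ e) (fin≈ e′) = fin≈ (trans e e′)
  ≈∞-trans ∞≈∞      ∞≈∞       = ∞≈∞

  ≤∞-reflexive : ∀ {x y} → x ≈∞ y → x ≤∞ y
  ≤∞-reflexive (fin≈ e) = fin≤ (≤-reflexive e)
  ≤∞-reflexive ∞≈∞      = ≤top

  ≤∞-trans : ∀ {x y z} → x ≤∞ y → y ≤∞ z → x ≤∞ z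
  ≤∞-trans (fin≤ h) (fin≤ h′) = fin≤ (≤-trans h h′)
  ≤∞-trans (fin≤ h) ≤top      = ≤top
  ≤∞-trans ≤top     ≤top      = ≤top

  ≤∞-refl : ∀ {x} → x ≤∞ x
  ≤∞-refl = ≤∞-reflexive ≈∞-refl

  ≤∞-total : ∀ x y → (x ≤∞ y) ⊎ (y ≤∞ x)
  ≤∞-total (fin x) (fin y) with total x y
  ... | inj₁ x≤y = inj₁ (fin≤ x≤y)
  ... | inj₂ y≤x = inj₂ (fin≤ y≤x)
  ≤∞-total (fin x) ∞ = inj₁ ≤top
  ≤∞-total ∞       y = inj₂ ≤top

  ≤∞-antisym : ∀ {x y} → x ≤∞ y → y ≤∞ x → x ≈∞ y
  ≤∞-antisym (fin≤ h) (fin≤ h′) = fin≈ (antisym h h′)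
  ≤∞-antisym ≤top     ≤top      = ∞≈∞

  ≤∞-isPartialOrder : IsPartialOrder _≈∞_ _≤∞_
  ≤∞-isPartialOrder = record
    { isPreorder = record
      { isEquivalence = record { refl = ≈∞-refl ; sym = ≈∞-sym ; trans = ≈∞-trans }
      ; reflexive     = ≤∞-reflexive
      ; trans         = ≤∞-trans }
    ; antisym = ≤∞-antisym }

  open StrictOrderProperties ≤∞-isPartialOrder public
    using () renaming (<-≤-trans to <∞-≤∞-trans; ≤-<-trans to ≤∞-<∞-trans;
                       <-respˡ-≈ to <∞-respˡ-≈∞; <-respʳ-≈ to <∞-respʳ-≈∞)

  ≤∞-respˡ-≈∞ : ∀ {x y z} → x ≈∞ y → x ≤∞ z → y ≤∞ z
  ≤∞-respˡ-≈∞ e h = ≤∞-trans (≤∞-reflexive (≈∞-sym e)) h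

  ≤∞-respʳ-≈∞ : ∀ {x y z} → y ≈∞ z → x ≤∞ y → x ≤∞ z
  ≤∞-respʳ-≈∞ e h = ≤∞-trans h (≤∞-reflexive e)

  fin-≈⁻ : ∀ {x y} → fin x ≈∞ fin y → x ≈ y
  fin-≈⁻ (fin≈ e) = e

  fin-≤⁻ : ∀ {x y} → fin x ≤∞ fin y → x ≤ y
  fin-≤⁻ (fin≤ h) = h

  fin-<⁻ : ∀ {x y} → fin x <∞ fin y → x < y
  fin-<⁻ (fin≤ h , x≉y) = h , λ e → x≉y (fin≈ e)

  fin-< : ∀ {x y} → x < y → fin x <∞ fin y
  fin-< (h , x≉y) = fin≤ h , λ { (fin≈ e) → x≉y e }

  ∞≤⇒≈∞ : ∀ {x} → ∞ ≤∞ x → x ≈∞ ∞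
  ∞≤⇒≈∞ ≤top = ∞≈∞

  +∞-cong : ∀ {x y z w} → x ≈∞ y → z ≈∞ w → (x +∞ z) ≈∞ (y +∞ w)
  +∞-cong (fin≈ e) (fin≈ e′) = fin≈ (∙-cong e e′)
  +∞-cong (fin≈ e) ∞≈∞       = ∞≈∞
  +∞-cong ∞≈∞      _         = ∞≈∞

  +∞-mono-≤∞ : ∀ {x y z w} → x ≤∞ y → z ≤∞ w → (x +∞ z) ≤∞ (y +∞ w)
  +∞-mono-≤∞ (fin≤ h) (fin≤ h′) = fin≤ (∙-mono-≤ h h′)
  +∞-mono-≤∞ (fin≤ h) ≤top      = ≤top
  +∞-mono-≤∞ ≤top     _         = ≤top

  ε+∞x≈∞x : ∀ x → (fin ε +∞ x) ≈∞ x
  ε+∞x≈∞x (fin x) = fin≈ (identityˡ x)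
  ε+∞x≈∞x ∞       = ∞≈∞

  ⊖-cong : ∀ {x y} δ → x ≈∞ y → (x ⊖ δ) ≈∞ (y ⊖ δ)
  ⊖-cong δ (fin≈ e) = fin≈ (∙-congʳ e)
  ⊖-cong δ ∞≈∞      = ∞≈∞

  x⊖ε≈x : ∀ x → (x ⊖ ε) ≈∞ x
  x⊖ε≈x (fin x) = fin≈ (trans (∙-congˡ ε⁻¹≈ε) (identityʳ x))
  x⊖ε≈x ∞       = ∞≈∞

  ⊖-monoˡ-≤∞ : ∀ {x y} δ → x ≤∞ y → (x ⊖ δ) ≤∞ (y ⊖ δ)
  ⊖-monoˡ-≤∞ δ (fin≤ h) = fin≤ (≤-compat _ h)
  ⊖-monoˡ-≤∞ δ ≤top     = ≤top

-- The Frobenius endomorphism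

prime∤m! : ∀ {p} → Prime p → ∀ m → m ℕ.< p → ¬ (p ∣ m !)
prime∤m! {p} pp zero    m<p p∣1 = ℕₚ.<⇒≱ (nonTrivial⇒n>1 p {{prime⇒nonTrivial pp}}) (∣⇒≤ p∣1)
prime∤m! {p} pp (suc m) m<p p∣m! with euclidsLemma (suc m) (m !) pp p∣m!
... | inj₁ p∣1+m = ℕₚ.<⇒≱ m<p (∣⇒≤ p∣1+m)
... | inj₂ p∣m!′ = prime∤m! pp m (ℕₚ.<-trans (ℕₚ.n<1+n m) m<p) p∣m!′

prime∣pCk : ∀ {p} → Prime p → ∀ k → 0 ℕ.< k → k ℕ.< p → p ∣ (p C k)
prime∣pCk {p} pp k 0<k k<p
  with euclidsLemma (p C k) (k ! ℕ.* (p ∸ k) !) pp p∣pCk*k!*[p-k]!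
  where
  instance
    k!*[p-k]!≢0 : NonZero (k ! ℕ.* (p ∸ k) !)
    k!*[p-k]!≢0 = k !* (p ∸ k) !≢0
  pCk*k!*[p-k]!≡p! : (p C k) ℕ.* (k ! ℕ.* (p ∸ k) !) ≡.≡ p !
  pCk*k!*[p-k]!≡p! = ≡.trans (≡.cong (ℕ._* (k ! ℕ.* (p ∸ k) !)) (nCk≡n!/k![n-k]! (ℕₚ.<⇒≤ k<p)))
                             (m/n*n≡m (k![n∸k]!∣n! (ℕₚ.<⇒≤ k<p)))
  p∣pCk*k!*[p-k]! : p ∣ (p C k) ℕ.* (k ! ℕ.* (p ∸ k) !)
  p∣pCk*k!*[p-k]! = ≡.subst (p ∣_) (≡.sym pCk*k!*[p-k]!≡p!) (n∣n! p (ℕₚ.<-trans 0<k k<p))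
    where
    n∣n! : ∀ n → 0 ℕ.< n → n ∣ n !
    n∣n! (suc n) _ = m∣m*n (n !)
... | inj₁ p∣pCk = p∣pCk
... | inj₂ p∣k!*[p-k]! with euclidsLemma (k !) ((p ∸ k) !) pp p∣k!*[p-k]!
...   | inj₁ p∣k! = ⊥-elim (prime∤m! pp k k<p p∣k!)
...   | inj₂ p∣[p-k]! = ⊥-elim (prime∤m! pp (p ∸ k) (ℕₚ.∸-monoʳ-< 0<k (ℕₚ.<⇒≤ k<p)) p∣[p-k]!)

module Frobenius {a ℓ} (R : CommutativeRing a ℓ) {p} (pp : Prime p) where
  open CommutativeRing R hiding (zero)
  open MultProperties semiring using (×-congʳ; ×-cong; ×-assoc-*; ×1-homo-*) renaming (_×_ to _·_)
  open ExpProperties semiring using (_^_; ^-congʳ)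
  open SumProperties +-monoid using (sum; sum-init-last; sum-cong-≋; sum-replicate-zero)
  open Binomial commutativeSemiring using (theorem; binomialExpansion)
  open import Relation.Binary.Reasoning.Setoid setoid

  module _ (p×1≈0 : p · 1# ≈ 0#) where

    p∣n⇒n·x≈0 : ∀ n x → p ∣ n → n · x ≈ 0#
    p∣n⇒n·x≈0 n x (divides m ≡.refl) = begin
      (m ℕ.* p) · x            ≈⟨ ×-congʳ (m ℕ.* p) (*-identityˡ x) ⟨
      (m ℕ.* p) · (1# * x)     ≈⟨ ×-assoc-* (m ℕ.* p) 1# x ⟨
      ((m ℕ.* p) · 1#) * x     ≈⟨ *-congʳ (×1-homo-* m p) ⟩
      ((m · 1#) * (p · 1#)) * x ≈⟨ *-congʳ (*-congˡ p×1≈0) ⟩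
      ((m · 1#) * 0#) * x      ≈⟨ *-congʳ (zeroʳ _) ⟩
      0# * x                   ≈⟨ zeroˡ x ⟩
      0#                       ∎

    -- Of the binomial expansion only the two extreme terms survive.
    frobenius-+ : ∀ x y → (x + y) ^ p ≈ x ^ p + y ^ p
    frobenius-+ x y with nonTrivial⇒n>1 p {{prime⇒nonTrivial pp}}
    ... | s≤s (s≤s {n = q} _) = begin
      (x + y) ^ p                          ≈⟨ theorem p x y ⟩
      binomialExpansion x y p              ≈⟨ +-congˡ (sum-init-last inner) ⟩
      term Fin.zero + (sum (Vinit inner) + term (Fin.suc (fromℕ (suc q))))
                                           ≈⟨ +-cong (+-identityʳ _) (+-cong innerTerms≈0 lastTerm) ⟩
      1# * y ^ p + (0# + x ^ p)            ≈⟨ +-cong (*-identityˡ _) (+-identityˡ _) ⟩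
      y ^ p + x ^ p                        ≈⟨ +-comm _ _ ⟩
      x ^ p + y ^ p                        ∎
      where
      open import Data.Vec.Functional using () renaming (init to Vinit)
      monomial : Fin (suc p) → Carrier
      monomial k = x ^ toℕ k * y ^ (p ∸ toℕ k)
      term : Fin (suc p) → Carrier
      term k = (p C toℕ k) · monomial k
      inner : Fin p → Carrier
      inner k = term (Fin.suc k)
      innerTerms≈0 : sum (Vinit inner) ≈ 0#
      innerTerms≈0 = trans (sum-cong-≋ (λ i → p∣n⇒n·x≈0 _ (monomial (Fin.suc (inject₁ i))) (p∣middle i))) (sum-replicate-zero (suc q))
        where
        p∣middle : ∀ (i : Fin (suc q)) → p ∣ (p C toℕ (Fin.suc (inject₁ i)))
        p∣middle i = ≡.subst (λ j → p ∣ (p C suc j)) (≡.sym (toℕ-inject₁ i))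
                       (prime∣pCk pp (suc (toℕ i)) (s≤s z≤n) (s≤s (toℕ<n i)))
      lastTerm : term (Fin.suc (fromℕ (suc q))) ≈ x ^ p
      lastTerm = topTerm _ (≡.cong suc (toℕ-fromℕ (suc q)))
        where
        topTerm : ∀ k → k ≡.≡ p → (p C k) · (x ^ k * y ^ (p ∸ k)) ≈ x ^ p
        topTerm k ≡.refl = trans (×-cong (nCn≡1 p) (*-congˡ (^-congʳ y (ℕₚ.n∸n≡0 p))))
                               (trans (+-identityʳ _) (*-identityʳ _))

module ValuedFieldProperties {k ℓ ℓΓ ℓΓ′} (K : ValuedField k ℓ ℓΓ ℓΓ′) where
  open ValuedField K hiding (zero)
  open OrderedAbelianGroupProperties Γ
  open ExtendedValueProperties Γ
  open RingProperties ring using (-1*x≈-x)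
  open import Algebra.Properties.AbelianGroup +-abelianGroup public
    using (x∙y⁻¹≈ε⇒x≈y; ⁻¹-anti-homo‿-; ⁻¹-∙-comm)
    renaming (//-rightDividesˡ to x-y+y≈x; //-rightDividesʳ to x+y-y≈x;
              ⁻¹-involutive to -‿involutive; ε⁻¹≈ε to -0≈0)
  open import Relation.Binary.Reasoning.Setoid setoid

  data ValueView (x : Carrier) : Set (ℓΓ ⊔ ℓΓ′) where
    infinite : v x ≈∞ ∞ → ValueView x
    finite   : ∀ α → v x ≈∞ fin α → ValueView x

  valueView : ∀ x → ValueView x
  valueView x with v x in eq
  ... | fin α = finite α (≡.subst (_≈∞ fin α) (≡.sym eq) ≈∞-refl)
  ... | ∞     = infinite (≡.subst (_≈∞ ∞) (≡.sym eq) ∞≈∞)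

  x≈0⇒v≈∞ : ∀ {x} → x ≈ 0# → v x ≈∞ ∞
  x≈0⇒v≈∞ e = ≈∞-trans (v-cong e) v-0

  v≈fin⇒≉0 : ∀ {x α} → v x ≈∞ fin α → ¬ (x ≈ 0#)
  v≈fin⇒≉0 hx e with ≈∞-trans (≈∞-sym hx) (x≈0⇒v≈∞ e)
  ... | ()

  v-*-fin : ∀ {x y α β} → v x ≈∞ fin α → v y ≈∞ fin β → v (x * y) ≈∞ fin (α Γ.∙ β)
  v-*-fin {x} {y} hx hy = ≈∞-trans (v-* x y) (+∞-cong hx hy)

  v-1 : v 1# ≈∞ fin Γ.ε
  v-1 with valueView 1#
  ... | infinite h = ⊥-elim (1≉0 (v-∞⇒0 1# h))
  ... | finite α h = ≈∞-trans h (fin≈ (∙-cancelʳ α (Γ.trans (fin-≈⁻ α∙α≈α) (Γ.sym (Γ.identityˡ α)))))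
    where
    α∙α≈α : fin (α Γ.∙ α) ≈∞ fin α
    α∙α≈α = ≈∞-trans (≈∞-sym (v-*-fin h h)) (≈∞-trans (v-cong (*-identityˡ 1#)) h)

  v-neg : ∀ x → v (- x) ≈∞ v x
  v-neg x = ≈∞-trans (v-cong (sym (-1*x≈-x x)))
              (≈∞-trans (v-* (- 1#) x) (≈∞-trans (+∞-cong v-[-1] ≈∞-refl) (ε+∞x≈∞x (v x))))
    where
    v-[-1] : v (- 1#) ≈∞ fin Γ.ε
    v-[-1] with valueView (- 1#)
    ... | infinite h = ⊥-elim (1≉0 (begin
      1#        ≈⟨ -‿involutive 1# ⟨
      - (- 1#)  ≈⟨ -‿cong (v-∞⇒0 _ h) ⟩
      - 0#      ≈⟨ -0≈0 ⟩
      0#        ∎))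
    ... | finite α h = ≈∞-trans h (fin≈ (x∙x≈ε⇒x≈ε (fin-≈⁻ α∙α≈ε)))
      where
      α∙α≈ε : fin (α Γ.∙ α) ≈∞ fin Γ.ε
      α∙α≈ε = ≈∞-trans (≈∞-sym (v-*-fin h h))
                (≈∞-trans (v-cong (trans (-1*x≈-x (- 1#)) (-‿involutive 1#))) v-1)

  infix 4 _≼_
  _≼_ : Γ.Carrier → Carrier → Set (ℓΓ ⊔ ℓΓ′)
  β ≼ x = fin β ≤∞ v x

  v≈fin⇒≼ : ∀ {β x} → v x ≈∞ fin β → β ≼ x
  v≈fin⇒≼ h = ≤∞-reflexive (≈∞-sym h)

  ≼-respʳ-≈ : ∀ {β x y} → x ≈ y → β ≼ x → β ≼ y
  ≼-respʳ-≈ e h = ≤∞-respʳ-≈∞ (v-cong e) h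

  ≼-respˡ-≈ : ∀ {β γ x} → β Γ.≈ γ → β ≼ x → γ ≼ x
  ≼-respˡ-≈ e h = ≤∞-respˡ-≈∞ (fin≈ e) h

  ≤-≼-trans : ∀ {β γ x} → γ Γ.≤ β → β ≼ x → γ ≼ x
  ≤-≼-trans γ≤β h = ≤∞-trans (fin≤ γ≤β) h

  ≼-0 : ∀ {β} → β ≼ 0#
  ≼-0 = ≤∞-respʳ-≈∞ (≈∞-sym v-0) ≤top

  ≼-+ : ∀ {β x y} → β ≼ x → β ≼ y → β ≼ (x + y)
  ≼-+ {β} {x} {y} = v-+ x y (fin β)

  ≼-neg : ∀ {β x} → β ≼ x → β ≼ (- x)
  ≼-neg {x = x} h = ≤∞-respʳ-≈∞ (≈∞-sym (v-neg x)) h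

  ≼-- : ∀ {β x y} → β ≼ x → β ≼ y → β ≼ (x - y)
  ≼-- hx hy = ≼-+ hx (≼-neg hy)

  ≼-* : ∀ {α β x y} → α ≼ x → β ≼ y → (α Γ.∙ β) ≼ (x * y)
  ≼-* {x = x} {y} hx hy = ≤∞-respʳ-≈∞ (≈∞-sym (v-* x y)) (+∞-mono-≤∞ hx hy)

  ≼-*𝒪ˡ : ∀ {β x y} → y ∈𝒪 → β ≼ x → β ≼ (y * x)
  ≼-*𝒪ˡ hy hx = ≼-respˡ-≈ (Γ.identityˡ _) (≼-* hy hx)

  ≼-*𝒪ʳ : ∀ {β x y} → y ∈𝒪 → β ≼ x → β ≼ (x * y)
  ≼-*𝒪ʳ hy hx = ≼-respʳ-≈ (*-comm _ _) (≼-*𝒪ˡ hy hx)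

  v≈fin⇒∈𝒪 : ∀ {x α} → Γ.ε Γ.≤ α → v x ≈∞ fin α → x ∈𝒪
  v≈fin⇒∈𝒪 ε≤α h = ≤-≼-trans ε≤α (v≈fin⇒≼ h)

  𝒪-1 : 1# ∈𝒪
  𝒪-1 = v≈fin⇒≼ v-1

  𝒪-0 : 0# ∈𝒪
  𝒪-0 = ≼-0

  𝒪-* : ∀ {x y} → x ∈𝒪 → y ∈𝒪 → (x * y) ∈𝒪
  𝒪-* = ≼-*𝒪ˡ

  𝒪-+ : ∀ {x y} → x ∈𝒪 → y ∈𝒪 → (x + y) ∈𝒪
  𝒪-+ = ≼-+

  𝒪-- : ∀ {x y} → x ∈𝒪 → y ∈𝒪 → (x - y) ∈𝒪
  𝒪-- = ≼--

  𝒪-resp-≈ : ∀ {x y} → x ≈ y → x ∈𝒪 → y ∈𝒪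
  𝒪-resp-≈ = ≼-respʳ-≈

  v-sub-comm : ∀ x y → v (x - y) ≈∞ v (y - x)
  v-sub-comm x y = ≈∞-trans (≈∞-sym (v-neg _)) (v-cong (⁻¹-anti-homo‿- x y))

  v-+-dominant : ∀ {x z α} → v x ≈∞ fin α → fin α <∞ v z → v (x + z) ≈∞ fin α
  v-+-dominant {x} {z} {α} hx (α≤z , α≉z) = ≤∞-antisym x+z≤α (≼-+ (v≈fin⇒≼ hx) α≤z)
    where
    bound⇒≤α : ∀ {γ} → γ ≤∞ v (x + z) → γ ≤∞ v z → γ ≤∞ fin α
    bound⇒≤α {γ} h h′ = ≤∞-respʳ-≈∞ (≈∞-trans (v-cong (x+y-y≈x z x)) hx)
                          (v-+ (x + z) (- z) γ h (≤∞-respʳ-≈∞ (≈∞-sym (v-neg z)) h′))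
    x+z≤α : v (x + z) ≤∞ fin α
    x+z≤α with ≤∞-total (v (x + z)) (v z)
    ... | inj₁ x+z≤z = bound⇒≤α ≤∞-refl x+z≤z
    ... | inj₂ z≤x+z = ⊥-elim (α≉z (≤∞-antisym α≤z (bound⇒≤α z≤x+z ≤∞-refl)))

  inv : ∀ x → ¬ (x ≈ 0#) → Carrier
  inv x x≉0 = proj₁ (inverse x x≉0)

  *-inverseʳ : ∀ x x≉0 → x * inv x x≉0 ≈ 1#
  *-inverseʳ x x≉0 = proj₂ (inverse x x≉0)

  x*[y*x⁻¹]≈y : ∀ x y x≉0 → x * (y * inv x x≉0) ≈ y
  x*[y*x⁻¹]≈y x y x≉0 = begin
    x * (y * inv x x≉0)   ≈⟨ *-congˡ (*-comm _ _) ⟩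
    x * (inv x x≉0 * y)   ≈⟨ *-assoc _ _ _ ⟨
    (x * inv x x≉0) * y   ≈⟨ *-congʳ (*-inverseʳ x x≉0) ⟩
    1# * y                ≈⟨ *-identityˡ y ⟩
    y                     ∎

  v-inv : ∀ {x α} (x≉0 : ¬ (x ≈ 0#)) → v x ≈∞ fin α → v (inv x x≉0) ≈∞ fin (α Γ.⁻¹)
  v-inv {x} {α} x≉0 hx with valueView (inv x x≉0)
  ... | infinite h = ⊥-elim (1≉0 (begin
    1#              ≈⟨ *-inverseʳ x x≉0 ⟨
    x * inv x x≉0   ≈⟨ *-congˡ (v-∞⇒0 _ h) ⟩
    x * 0#          ≈⟨ zeroʳ x ⟩
    0#              ∎))
  ... | finite β h = ≈∞-trans h (fin≈ (inverseʳ-unique α β (fin-≈⁻ α∙β≈ε)))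
    where
    α∙β≈ε : fin (α Γ.∙ β) ≈∞ fin Γ.ε
    α∙β≈ε = ≈∞-trans (≈∞-sym (v-*-fin hx h)) (≈∞-trans (v-cong (*-inverseʳ x x≉0)) v-1)

  ≼-*-inv : ∀ {x c γ β} (c≉0 : ¬ (c ≈ 0#)) → v c ≈∞ fin γ → (γ Γ.∙ β) ≼ x → β ≼ (x * inv c c≉0)
  ≼-*-inv {γ = γ} {β} c≉0 vc h = ≼-respˡ-≈ (xyx⁻¹≈y γ β) (≼-* h (v≈fin⇒≼ (v-inv c≉0 vc)))
    where open import Algebra.Properties.AbelianGroup Γ.abelianGroup using (xyx⁻¹≈y)

  x+[y-x]≈y : ∀ x y → x + (y - x) ≈ y
  x+[y-x]≈y x y = trans (+-comm _ _) (x-y+y≈x x y)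

  [x-y]+[y-z]≈x-z : ∀ x y z → (x - y) + (y - z) ≈ x - z
  [x-y]+[y-z]≈x-z x y z = begin
    (x - y) + (y - z)   ≈⟨ +-assoc x (- y) (y - z) ⟩
    x + (- y + (y - z)) ≈⟨ +-congˡ (+-assoc (- y) y (- z)) ⟨
    x + ((- y + y) - z) ≈⟨ +-congˡ (+-congʳ (-‿inverseˡ y)) ⟩
    x + (0# - z)        ≈⟨ +-congˡ (+-identityˡ (- z)) ⟩
    x - z               ∎

  [x-y]-[x-z]≈z-y : ∀ x y z → (x - y) - (x - z) ≈ z - y
  [x-y]-[x-z]≈z-y x y z = begin
    (x - y) - (x - z)   ≈⟨ +-congˡ (⁻¹-anti-homo‿- x z) ⟩
    (x - y) + (z - x)   ≈⟨ +-comm _ _ ⟩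
    (z - x) + (x - y)   ≈⟨ [x-y]+[y-z]≈x-z z x y ⟩
    z - y               ∎

  x-[x+y]≈-y : ∀ x y → x - (x + y) ≈ - y
  x-[x+y]≈-y x y = begin
    x - (x + y)       ≈⟨ +-congˡ (⁻¹-∙-comm x y) ⟨
    x + (- x - y)     ≈⟨ +-assoc x (- x) (- y) ⟨
    (x - x) - y       ≈⟨ +-congʳ (-‿inverseʳ x) ⟩
    0# - y            ≈⟨ +-identityˡ _ ⟩
    - y               ∎

-- Difference polynomials over a valued field with an increasing endomorphism

module DifferencePolynomials {k ℓ ℓΓ ℓΓ′} (K : ValuedField k ℓ ℓΓ ℓΓ′) where
  open ValuedField K hiding (zero)
  open OrderedAbelianGroupProperties Γ
  open ExtendedValueProperties Γ
  open ValuedFieldProperties K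
  open RingProperties ring using (x+x≈x⇒x≈0)
  open import Algebra.Properties.AbelianGroup +-abelianGroup using (inverseˡ-unique)
  open import Relation.Binary.Reasoning.Setoid setoid

  record IsEndomorphism (τ : Carrier → Carrier) : Set (k ⊔ ℓ ⊔ ℓΓ ⊔ ℓΓ′) where
    field
      cong : ∀ {x y} → x ≈ y → τ x ≈ τ y
      +-homo : ∀ x y → τ (x + y) ≈ τ x + τ y
      *-homo : ∀ x y → τ (x * y) ≈ τ x * τ y
      1-homo : τ 1# ≈ 1#
      𝒪-homo : ∀ {x} → x ∈𝒪 → τ x ∈𝒪

    0-homo : τ 0# ≈ 0#
    0-homo = x+x≈x⇒x≈0 (τ 0#) (trans (sym (+-homo 0# 0#)) (cong (+-identityʳ 0#)))

    -‿homo : ∀ x → τ (- x) ≈ - τ x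
    -‿homo x = inverseˡ-unique (τ (- x)) (τ x)
      (trans (sym (+-homo (- x) x)) (trans (cong (-‿inverseˡ x)) 0-homo))

    ≉0-homo : ∀ {x} → ¬ (x ≈ 0#) → ¬ (τ x ≈ 0#)
    ≉0-homo {x} x≉0 τx≈0 = 1≉0 (begin
      1#                      ≈⟨ 1-homo ⟨
      τ 1#                    ≈⟨ cong (*-inverseʳ x x≉0) ⟨
      τ (x * inv x x≉0)       ≈⟨ *-homo _ _ ⟩
      τ x * τ (inv x x≉0)     ≈⟨ *-congʳ τx≈0 ⟩
      0# * τ (inv x x≉0)      ≈⟨ zeroˡ _ ⟩
      0#                      ∎)

  iter-suc : ∀ (τ : Carrier → Carrier) n x → iter τ (suc n) x ≡.≡ iter τ n (τ x)
  iter-suc τ zero    x = ≡.refl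
  iter-suc τ (suc n) x = ≡.cong τ (iter-suc τ n x)

  isEndomorphism-iter : ∀ {τ} → IsEndomorphism τ → ∀ n → IsEndomorphism (iter τ n)
  isEndomorphism-iter T zero = record
    { cong = λ e → e ; +-homo = λ _ _ → refl ; *-homo = λ _ _ → refl ; 1-homo = refl ; 𝒪-homo = λ h → h }
  isEndomorphism-iter T (suc n) = record
    { cong   = λ e → cong (Tⁿ.cong e)
    ; +-homo = λ x y → trans (cong (Tⁿ.+-homo x y)) (+-homo _ _)
    ; *-homo = λ x y → trans (cong (Tⁿ.*-homo x y)) (*-homo _ _)
    ; 1-homo = trans (cong Tⁿ.1-homo) 1-homo
    ; 𝒪-homo = λ h → 𝒪-homo (Tⁿ.𝒪-homo h) }
    where
    open IsEndomorphism T
    module Tⁿ = IsEndomorphism (isEndomorphism-iter T n)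

  isEndomorphism-∘ : ∀ {τ ψ} → IsEndomorphism τ → IsEndomorphism ψ → IsEndomorphism (λ x → τ (ψ x))
  isEndomorphism-∘ T Ψ = record
    { cong   = λ e → T.cong (Ψ.cong e)
    ; +-homo = λ x y → trans (T.cong (Ψ.+-homo x y)) (T.+-homo _ _)
    ; *-homo = λ x y → trans (T.cong (Ψ.*-homo x y)) (T.*-homo _ _)
    ; 1-homo = trans (T.cong Ψ.1-homo) T.1-homo
    ; 𝒪-homo = λ h → T.𝒪-homo (Ψ.𝒪-homo h) }
    where
    module T = IsEndomorphism T
    module Ψ = IsEndomorphism Ψ

  record IsIncreasingEndomorphism (τ : Carrier → Carrier) : Set (k ⊔ ℓ ⊔ ℓΓ ⊔ ℓΓ′) where
    field
      isEndomorphism : IsEndomorphism τ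
      growth : ∀ {x α} → v x ≈∞ fin α → Γ.ε Γ.< α → (α Γ.∙ α) ≼ τ x
    open IsEndomorphism isEndomorphism public

  module Transformal {τ} (T : IsIncreasingEndomorphism τ) where
    open IsIncreasingEndomorphism T
    module Tⁿ n = IsEndomorphism (isEndomorphism-iter isEndomorphism n)
    open RingSolver commutativeSemiring using (solve; _:+_; _:*_; _:=_)
    open import Algebra.Properties.CommutativeSemigroup +-commutativeSemigroup
      using () renaming (interchange to +-interchange)

    [a+r][b+s]≈ab+[as+r[b+s]] : ∀ a r b s → (a + r) * (b + s) ≈ a * b + (a * s + r * (b + s))
    [a+r][b+s]≈ab+[as+r[b+s]] = solve 4 (λ a r b s →
      (a :+ r) :* (b :+ s) := (a :* b) :+ ((a :* s) :+ (r :* (b :+ s)))) refl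

    ≼-growth : ∀ {β x} → Γ.ε Γ.< β → β ≼ x → (β Γ.∙ β) ≼ τ x
    ≼-growth {β} {x} ε<β β≼x with valueView x
    ... | infinite h = ≼-respʳ-≈ (sym (trans (cong (v-∞⇒0 x h)) 0-homo)) ≼-0
    ... | finite μ h = ≤-≼-trans (∙-mono-≤ β≤μ β≤μ) (growth h (<-≤-trans ε<β β≤μ))
      where
      β≤μ : β Γ.≤ μ
      β≤μ = fin-≤⁻ (≤∞-respʳ-≈∞ h β≼x)

    ≼-iter : ∀ {β x} → Γ.ε Γ.< β → β ≼ x → ∀ j → β ≼ iter τ j x
    ≼-iter ε<β h zero    = h
    ≼-iter ε<β h (suc j) = ≤-≼-trans (ε≤x⇒y≤x∙y (<⇒≤ ε<β)) (≼-growth ε<β (≼-iter ε<β h j))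

    ≼-iter-suc : ∀ {β x} → Γ.ε Γ.< β → β ≼ x → ∀ j → (β Γ.∙ β) ≼ iter τ (suc j) x
    ≼-iter-suc ε<β h j = ≼-growth ε<β (≼-iter ε<β h j)

    eval-cong : ∀ f {x y} → x ≈ y → eval τ f x ≈ eval τ f y
    eval-cong (con a) e = refl
    eval-cong (var j) e = Tⁿ.cong j e
    eval-cong (f ⊕ h) e = +-cong (eval-cong f e) (eval-cong h e)
    eval-cong (f ⊗ h) e = *-cong (eval-cong f e) (eval-cong h e)

    eval-𝒪 : ∀ f {x} → CoeffsIn𝒪 f → x ∈𝒪 → eval τ f x ∈𝒪
    eval-𝒪 (con a) hf       hx = hf
    eval-𝒪 (var j) hf       hx = Tⁿ.𝒪-homo j hx
    eval-𝒪 (f ⊕ h) (hf , hh) hx = 𝒪-+ (eval-𝒪 f hf hx) (eval-𝒪 h hh hx)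
    eval-𝒪 (f ⊗ h) (hf , hh) hx = 𝒪-* (eval-𝒪 f hf hx) (eval-𝒪 h hh hx)

    deriv-𝒪 : ∀ f → CoeffsIn𝒪 f → CoeffsIn𝒪 (deriv f)
    deriv-𝒪 (con a)       hf        = 𝒪-0
    deriv-𝒪 (var zero)    hf        = 𝒪-1
    deriv-𝒪 (var (suc j)) hf        = 𝒪-0
    deriv-𝒪 (f ⊕ h)       (hf , hh) = deriv-𝒪 f hf , deriv-𝒪 h hh
    deriv-𝒪 (f ⊗ h)       (hf , hh) = (deriv-𝒪 f hf , hh) , (hf , deriv-𝒪 h hh)

    eval-deriv-𝒪 : ∀ f {x} → CoeffsIn𝒪 f → x ∈𝒪 → eval τ (deriv f) x ∈𝒪
    eval-deriv-𝒪 f hf = eval-𝒪 (deriv f) (deriv-𝒪 f hf)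

    taylor₀ : ∀ f {x e β} → CoeffsIn𝒪 f → x ∈𝒪 → e ∈𝒪 → β ≼ e →
              (∀ j → β ≼ iter τ (suc j) e) →
              Σ Carrier (λ r → β ≼ r × eval τ f (x + e) ≈ eval τ f x + r)
    taylor₀ (con a)       hf hx he h₀ hⱼ = 0# , ≼-0 , sym (+-identityʳ a)
    taylor₀ (var zero)    hf hx he h₀ hⱼ = _ , h₀ , refl
    taylor₀ (var (suc j)) {x} {e} hf hx he h₀ hⱼ = _ , hⱼ j , Tⁿ.+-homo (suc j) x e
    taylor₀ (f ⊕ h) (hf , hh) hx he h₀ hⱼ
      with taylor₀ f hf hx he h₀ hⱼ | taylor₀ h hh hx he h₀ hⱼ
    ... | r₁ , β≼r₁ , e₁ | r₂ , β≼r₂ , e₂ =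
      r₁ + r₂ , ≼-+ β≼r₁ β≼r₂ , trans (+-cong e₁ e₂) (+-interchange _ _ _ _)
    taylor₀ (f ⊗ h) {x} {e} (hf , hh) hx he h₀ hⱼ
      with taylor₀ f hf hx he h₀ hⱼ | taylor₀ h hh hx he h₀ hⱼ
    ... | r₁ , β≼r₁ , e₁ | r₂ , β≼r₂ , e₂ =
      _ , ≼-+ (≼-*𝒪ˡ (eval-𝒪 f hf hx) β≼r₂) (≼-*𝒪ʳ (𝒪-resp-≈ e₂ (eval-𝒪 h hh (𝒪-+ hx he))) β≼r₁) ,
      trans (*-cong e₁ e₂) ([a+r][b+s]≈ab+[as+r[b+s]] _ _ _ _)

    taylor₁ : ∀ f {x e β} → CoeffsIn𝒪 f → x ∈𝒪 → e ∈𝒪 → β ≼ (e * e) →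
              (∀ j → β ≼ iter τ (suc j) e) →
              Σ Carrier (λ r → β ≼ r × eval τ f (x + e) ≈ eval τ f x + eval τ (deriv f) x * e + r)
    taylor₁ (con a) {x} {e} hf hx he h₀ hⱼ = 0# , ≼-0 , sym (begin
      a + 0# * e + 0#    ≈⟨ +-identityʳ _ ⟩
      a + 0# * e         ≈⟨ +-congˡ (zeroˡ e) ⟩
      a + 0#             ≈⟨ +-identityʳ a ⟩
      a                  ∎)
    taylor₁ (var zero) {x} {e} hf hx he h₀ hⱼ = 0# , ≼-0 , sym (begin
      x + 1# * e + 0#    ≈⟨ +-identityʳ _ ⟩
      x + 1# * e         ≈⟨ +-congˡ (*-identityˡ e) ⟩
      x + e              ∎)
    taylor₁ (var (suc j)) {x} {e} hf hx he h₀ hⱼ = _ , hⱼ j , (begin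
      iter τ (suc j) (x + e)                  ≈⟨ Tⁿ.+-homo (suc j) x e ⟩
      iter τ (suc j) x + iter τ (suc j) e     ≈⟨ +-congʳ (+-identityʳ _) ⟨
      iter τ (suc j) x + 0# + iter τ (suc j) e ≈⟨ +-congʳ (+-congˡ (zeroˡ e)) ⟨
      iter τ (suc j) x + 0# * e + iter τ (suc j) e ∎)
    taylor₁ (f ⊕ h) (hf , hh) hx he h₀ hⱼ
      with taylor₁ f hf hx he h₀ hⱼ | taylor₁ h hh hx he h₀ hⱼ
    ... | r₁ , β≼r₁ , e₁ | r₂ , β≼r₂ , e₂ =
      r₁ + r₂ , ≼-+ β≼r₁ β≼r₂ , trans (+-cong e₁ e₂) (collect _ _ _ _ _ _ _)
      where
      collect : ∀ a b r a′ b′ r′ e → (a + b * e + r) + (a′ + b′ * e + r′) ≈ (a + a′) + (b + b′) * e + (r + r′)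
      collect = solve 7 (λ a b r a′ b′ r′ e →
        (a :+ b :* e :+ r) :+ (a′ :+ b′ :* e :+ r′) := (a :+ a′) :+ (b :+ b′) :* e :+ (r :+ r′)) refl
    taylor₁ (f ⊗ h) {x} {e} (hf , hh) hx he h₀ hⱼ
      with taylor₁ f hf hx he h₀ hⱼ | taylor₁ h hh hx he h₀ hⱼ
    ... | r₁ , β≼r₁ , e₁ | r₂ , β≼r₂ , e₂ =
      _ , ≼-+ (≼-+ (≼-*𝒪ˡ (𝒪-* f′x𝒪 h′x𝒪) h₀) (≼-*𝒪ˡ (𝒪-+ (eval-𝒪 f hf hx) (𝒪-* f′x𝒪 he)) β≼r₂))
              (≼-*𝒪ʳ (𝒪-resp-≈ e₂ (eval-𝒪 h hh (𝒪-+ hx he))) β≼r₁) ,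
      trans (*-cong e₁ e₂) (expand _ _ _ _ _ _ _)
      where
      f′x𝒪 : eval τ (deriv f) x ∈𝒪
      f′x𝒪 = eval-deriv-𝒪 f hf hx
      h′x𝒪 : eval τ (deriv h) x ∈𝒪
      h′x𝒪 = eval-deriv-𝒪 h hh hx
      expand : ∀ a b r a′ b′ r′ e → (a + b * e + r) * (a′ + b′ * e + r′) ≈
        a * a′ + (b * a′ + a * b′) * e + ((b * b′) * (e * e) + (a + b * e) * r′ + r * (a′ + b′ * e + r′))
      expand = solve 7 (λ a b r a′ b′ r′ e → (a :+ b :* e :+ r) :* (a′ :+ b′ :* e :+ r′) :=
        (a :* a′) :+ ((b :* a′) :+ (a :* b′)) :* e :+ ((b :* b′) :* (e :* e) :+ (a :+ b :* e) :* r′ :+ r :* (a′ :+ b′ :* e :+ r′))) refl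

    freeze : DPoly → Carrier → DPoly
    freeze (con a)       z = con a
    freeze (var zero)    z = var zero
    freeze (var (suc j)) z = con (iter τ (suc j) z)
    freeze (f ⊕ h)       z = freeze f z ⊕ freeze h z
    freeze (f ⊗ h)       z = freeze f z ⊗ freeze h z

    freeze-algebraic : ∀ f z → Algebraic (freeze f z)
    freeze-algebraic (con a)       z = tt
    freeze-algebraic (var zero)    z = ≡.refl
    freeze-algebraic (var (suc j)) z = tt
    freeze-algebraic (f ⊕ h)       z = freeze-algebraic f z , freeze-algebraic h z
    freeze-algebraic (f ⊗ h)       z = freeze-algebraic f z , freeze-algebraic h z

    freeze-𝒪 : ∀ f {z} → CoeffsIn𝒪 f → z ∈𝒪 → CoeffsIn𝒪 (freeze f z)
    freeze-𝒪 (con a)       hf        hz = hf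
    freeze-𝒪 (var zero)    hf        hz = _
    freeze-𝒪 (var (suc j)) hf        hz = Tⁿ.𝒪-homo (suc j) hz
    freeze-𝒪 (f ⊕ h)       (hf , hh) hz = freeze-𝒪 f hf hz , freeze-𝒪 h hh hz
    freeze-𝒪 (f ⊗ h)       (hf , hh) hz = freeze-𝒪 f hf hz , freeze-𝒪 h hh hz

    eval-freeze : ∀ f z → eval τ (freeze f z) z ≈ eval τ f z
    eval-freeze (con a)       z = refl
    eval-freeze (var zero)    z = refl
    eval-freeze (var (suc j)) z = refl
    eval-freeze (f ⊕ h)       z = +-cong (eval-freeze f z) (eval-freeze h z)
    eval-freeze (f ⊗ h)       z = *-cong (eval-freeze f z) (eval-freeze h z)

    eval-deriv-freeze : ∀ f z → eval τ (deriv (freeze f z)) z ≈ eval τ (deriv f) z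
    eval-deriv-freeze (con a)       z = refl
    eval-deriv-freeze (var zero)    z = refl
    eval-deriv-freeze (var (suc j)) z = refl
    eval-deriv-freeze (f ⊕ h)       z = +-cong (eval-deriv-freeze f z) (eval-deriv-freeze h z)
    eval-deriv-freeze (f ⊗ h)       z = +-cong (*-cong (eval-deriv-freeze f z) (eval-freeze h z))
                                               (*-cong (eval-freeze f z) (eval-deriv-freeze h z))

    eval-freeze-≼ : ∀ f {x z β} → CoeffsIn𝒪 f → x ∈𝒪 → z ∈𝒪 →
                    (∀ j → β ≼ iter τ (suc j) (x - z)) →
                    Σ Carrier (λ r → β ≼ r × eval τ f x ≈ eval τ (freeze f z) x + r)
    eval-freeze-≼ (con a)       hf hx hz hⱼ = 0# , ≼-0 , sym (+-identityʳ a)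
    eval-freeze-≼ (var zero)    hf hx hz hⱼ = 0# , ≼-0 , sym (+-identityʳ _)
    eval-freeze-≼ (var (suc j)) {x} {z} hf hx hz hⱼ =
      _ , ≼-respʳ-≈ (τʲ-sub (suc j)) (hⱼ j) , sym (x+[y-x]≈y _ _)
      where
      τʲ-sub : ∀ n → iter τ n (x - z) ≈ iter τ n x - iter τ n z
      τʲ-sub n = trans (Tⁿ.+-homo n x (- z)) (+-congˡ (Tⁿ.-‿homo n z))
    eval-freeze-≼ (f ⊕ h) (hf , hh) hx hz hⱼ
      with eval-freeze-≼ f hf hx hz hⱼ | eval-freeze-≼ h hh hx hz hⱼ
    ... | r₁ , β≼r₁ , e₁ | r₂ , β≼r₂ , e₂ =
      r₁ + r₂ , ≼-+ β≼r₁ β≼r₂ , trans (+-cong e₁ e₂) (+-interchange _ _ _ _)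
    eval-freeze-≼ (f ⊗ h) {x} {z} (hf , hh) hx hz hⱼ
      with eval-freeze-≼ f hf hx hz hⱼ | eval-freeze-≼ h hh hx hz hⱼ
    ... | r₁ , β≼r₁ , e₁ | r₂ , β≼r₂ , e₂ =
      _ , ≼-+ (≼-*𝒪ˡ (eval-𝒪 (freeze f z) (freeze-𝒪 f hf hz) hx) β≼r₂)
              (≼-*𝒪ʳ (𝒪-resp-≈ e₂ (eval-𝒪 h hh hx)) β≼r₁) ,
      trans (*-cong e₁ e₂) ([a+r][b+s]≈ab+[as+r[b+s]] _ _ _ _)

    nearIdentity : Carrier → Carrier → DPoly → DPoly
    nearIdentity u e r = (con u ⊕ var 0) ⊕ (con e ⊗ r)

    nearIdentity-hensel : ∀ {u e η} r → CoeffsIn𝒪 r → v u ≈∞ fin Γ.ε → v e ≈∞ fin η → Γ.ε Γ.< η →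
      fin Γ.ε <∞ v (eval τ (nearIdentity u e r) (- u)) ×
      v (eval τ (deriv (nearIdentity u e r)) (- u)) ≈∞ fin Γ.ε
    nearIdentity-hensel {u} {e} {η} r r𝒪 vu ve ε<η =
      <∞-≤∞-trans (fin-< ε<η) (≼-respʳ-≈ (sym u-u+er≈er) (η≼e* r𝒪)) ,
      v-+-dominant (≈∞-trans (v-cong (+-identityˡ 1#)) v-1)
        (<∞-≤∞-trans (fin-< ε<η) (≼-+ (≼-respʳ-≈ (sym (zeroˡ _)) ≼-0) (η≼e* (deriv-𝒪 r r𝒪))))
      where
      -u𝒪 : (- u) ∈𝒪
      -u𝒪 = v≈fin⇒≼ (≈∞-trans (v-neg u) vu)
      η≼e* : ∀ {s} → CoeffsIn𝒪 s → η ≼ e * eval τ s (- u)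
      η≼e* s𝒪 = ≼-respˡ-≈ (Γ.identityʳ η) (≼-* (v≈fin⇒≼ ve) (eval-𝒪 _ s𝒪 -u𝒪))
      u-u+er≈er : (u + - u) + e * eval τ r (- u) ≈ e * eval τ r (- u)
      u-u+er≈er = trans (+-congʳ (-‿inverseʳ u)) (+-identityˡ _)

    -- For d j = τʲ⁺¹(c)/c²:  f(a + c y) = f(a) + f′(a) c y + c² · remainder f (y).
    module Rescaling (a c : Carrier) (d : ℕ → Carrier)
                     (τc≈c²d : ∀ j → iter τ (suc j) c ≈ (c * c) * d j) where

      remainder : DPoly → DPoly
      remainder (con b)       = con 0#
      remainder (var zero)    = con 0#
      remainder (var (suc j)) = con (d j) ⊗ var (suc j)
      remainder (f ⊕ h)       = remainder f ⊕ remainder h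
      remainder (f ⊗ h)       =
        (con (eval τ (deriv f) a * eval τ (deriv h) a) ⊗ (var 0 ⊗ var 0))
        ⊕ (((con (eval τ f a) ⊕ (con (c * eval τ (deriv f) a) ⊗ var 0)) ⊗ remainder h)
        ⊕ (remainder f ⊗ ((con (eval τ h a) ⊕ (con (c * eval τ (deriv h) a) ⊗ var 0))
                          ⊕ (con (c * c) ⊗ remainder h))))

      remainder-algebraic : ∀ f → Algebraic f → Algebraic (remainder f)
      remainder-algebraic (con b)       _         = tt
      remainder-algebraic (var zero)    _         = tt
      remainder-algebraic (var (suc j)) ()
      remainder-algebraic (f ⊕ h)       (af , ah) = remainder-algebraic f af , remainder-algebraic h ah
      remainder-algebraic (f ⊗ h)       (af , ah) =
        (tt , (≡.refl , ≡.refl)) ,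
        (((tt , (tt , ≡.refl)) , remainder-algebraic h ah) ,
         (remainder-algebraic f af , ((tt , (tt , ≡.refl)) , (tt , remainder-algebraic h ah))))

      remainder-𝒪 : (∀ j → d j ∈𝒪) → a ∈𝒪 → c ∈𝒪 → ∀ f → CoeffsIn𝒪 f → CoeffsIn𝒪 (remainder f)
      remainder-𝒪 d𝒪 a𝒪 c𝒪 (con b)       _         = 𝒪-0
      remainder-𝒪 d𝒪 a𝒪 c𝒪 (var zero)    _         = 𝒪-0
      remainder-𝒪 d𝒪 a𝒪 c𝒪 (var (suc j)) _         = d𝒪 j , _
      remainder-𝒪 d𝒪 a𝒪 c𝒪 (f ⊕ h)       (hf , hh) = remainder-𝒪 d𝒪 a𝒪 c𝒪 f hf , remainder-𝒪 d𝒪 a𝒪 c𝒪 h hh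
      remainder-𝒪 d𝒪 a𝒪 c𝒪 (f ⊗ h)       (hf , hh) =
        (𝒪-* f′a𝒪 h′a𝒪 , (_ , _)) ,
        (((eval-𝒪 f hf a𝒪 , (𝒪-* c𝒪 f′a𝒪 , _)) , Rh) ,
         (remainder-𝒪 d𝒪 a𝒪 c𝒪 f hf , ((eval-𝒪 h hh a𝒪 , (𝒪-* c𝒪 h′a𝒪 , _)) , (𝒪-* c𝒪 c𝒪 , Rh))))
        where
        f′a𝒪 : eval τ (deriv f) a ∈𝒪
        f′a𝒪 = eval-deriv-𝒪 f hf a𝒪
        h′a𝒪 : eval τ (deriv h) a ∈𝒪
        h′a𝒪 = eval-deriv-𝒪 h hh a𝒪
        Rh : CoeffsIn𝒪 (remainder h)
        Rh = remainder-𝒪 d𝒪 a𝒪 c𝒪 h hh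

      eval-rescaled : ∀ f y → eval τ f (a + c * y) ≈
                      eval τ f a + eval τ (deriv f) a * (c * y) + (c * c) * eval τ (remainder f) y
      eval-rescaled (con b) y = sym (begin
        b + 0# * (c * y) + (c * c) * 0#   ≈⟨ +-congˡ (zeroʳ _) ⟩
        b + 0# * (c * y) + 0#             ≈⟨ +-identityʳ _ ⟩
        b + 0# * (c * y)                  ≈⟨ +-congˡ (zeroˡ _) ⟩
        b + 0#                            ≈⟨ +-identityʳ b ⟩
        b                                 ∎)
      eval-rescaled (var zero) y = sym (begin
        a + 1# * (c * y) + (c * c) * 0#   ≈⟨ +-congˡ (zeroʳ _) ⟩
        a + 1# * (c * y) + 0#             ≈⟨ +-identityʳ _ ⟩
        a + 1# * (c * y)                  ≈⟨ +-congˡ (*-identityˡ _) ⟩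
        a + c * y                         ∎)
      eval-rescaled (var (suc j)) y = begin
        τⁿ (a + c * y)                        ≈⟨ Tⁿ.+-homo n a (c * y) ⟩
        τⁿ a + τⁿ (c * y)                     ≈⟨ +-congˡ (Tⁿ.*-homo n c y) ⟩
        τⁿ a + τⁿ c * τⁿ y                    ≈⟨ +-congˡ (*-congʳ (τc≈c²d j)) ⟩
        τⁿ a + ((c * c) * d j) * τⁿ y         ≈⟨ +-congˡ (*-assoc _ _ _) ⟩
        τⁿ a + (c * c) * (d j * τⁿ y)         ≈⟨ +-congʳ (+-identityʳ _) ⟨
        τⁿ a + 0# + (c * c) * (d j * τⁿ y)    ≈⟨ +-congʳ (+-congˡ (zeroˡ _)) ⟨
        τⁿ a + 0# * (c * y) + (c * c) * (d j * τⁿ y) ∎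
        where
        n : ℕ
        n = suc j
        τⁿ : Carrier → Carrier
        τⁿ = iter τ n
      eval-rescaled (f ⊕ h) y = trans (+-cong (eval-rescaled f y) (eval-rescaled h y)) (collect _ _ _ _ _ _ _ _)
        where
        collect : ∀ a b q a′ b′ q′ e C → (a + b * e + C * q) + (a′ + b′ * e + C * q′) ≈ (a + a′) + (b + b′) * e + C * (q + q′)
        collect = solve 8 (λ a b q a′ b′ q′ e C →
          (a :+ b :* e :+ C :* q) :+ (a′ :+ b′ :* e :+ C :* q′) := (a :+ a′) :+ (b :+ b′) :* e :+ C :* (q :+ q′)) refl
      eval-rescaled (f ⊗ h) y = trans (*-cong (eval-rescaled f y) (eval-rescaled h y)) (expand _ _ _ _ _ _ c y)
        where
        expand : ∀ A₁ B₁ Q₁ A₂ B₂ Q₂ c y →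
          (A₁ + B₁ * (c * y) + (c * c) * Q₁) * (A₂ + B₂ * (c * y) + (c * c) * Q₂) ≈
          A₁ * A₂ + (B₁ * A₂ + A₁ * B₂) * (c * y) + (c * c) * ((B₁ * B₂) * (y * y)
            + ((A₁ + (c * B₁) * y) * Q₂ + Q₁ * ((A₂ + (c * B₂) * y) + (c * c) * Q₂)))
        expand = solve 8 (λ A₁ B₁ Q₁ A₂ B₂ Q₂ c y →
          (A₁ :+ B₁ :* (c :* y) :+ (c :* c) :* Q₁) :* (A₂ :+ B₂ :* (c :* y) :+ (c :* c) :* Q₂) :=
          A₁ :* A₂ :+ (B₁ :* A₂ :+ A₁ :* B₂) :* (c :* y) :+ (c :* c) :* (((B₁ :* B₂) :* (y :* y))
            :+ (((A₁ :+ (c :* B₁) :* y) :* Q₂) :+ (Q₁ :* ((A₂ :+ (c :* B₂) :* y) :+ (c :* c) :* Q₂))))) refl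

      eval-rescaled-nearIdentity : ∀ f {u e} y → (c * eval τ (deriv f) a) * u ≈ eval τ f a →
                        eval τ (deriv f) a * e ≈ c →
                        (c * eval τ (deriv f) a) * eval τ (nearIdentity u e (remainder f)) y ≈ eval τ f (a + c * y)
      eval-rescaled-nearIdentity f {u} {e} y cDu≈fa De≈c = begin
        (c * D) * ((u + y) + e * R)             ≈⟨ distribute c D u y e R ⟩
        (c * D) * u + D * (c * y) + ((c * D) * e) * R
                                                ≈⟨ +-cong (+-congʳ cDu≈fa) (*-congʳ (trans (*-assoc c D e) (*-congˡ De≈c))) ⟩
        eval τ f a + D * (c * y) + (c * c) * R  ≈⟨ eval-rescaled f y ⟨
        eval τ f (a + c * y)                    ∎
        where
        D : Carrier
        D = eval τ (deriv f) a
        R : Carrier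
        R = eval τ (remainder f) y
        distribute : ∀ c D u y e R → (c * D) * ((u + y) + e * R) ≈ (c * D) * u + D * (c * y) + ((c * D) * e) * R
        distribute = solve 6 (λ c D u y e R →
          (c :* D) :* ((u :+ y) :+ e :* R) := (c :* D) :* u :+ D :* (c :* y) :+ ((c :* D) :* e) :* R) refl

    module _ {c γ} (vc : v c ≈∞ fin γ) (ε<γ : Γ.ε Γ.< γ) where
      private
        c²≉0 : ¬ (c * c ≈ 0#)
        c²≉0 = v≈fin⇒≉0 (v-*-fin vc vc)

      τ-quotient : ℕ → Carrier
      τ-quotient j = iter τ (suc j) c * inv (c * c) c²≉0

      τ-quotient-eq : ∀ j → iter τ (suc j) c ≈ (c * c) * τ-quotient j
      τ-quotient-eq j = sym (x*[y*x⁻¹]≈y (c * c) _ c²≉0)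

      τ-quotient-𝒪 : ∀ j → τ-quotient j ∈𝒪
      τ-quotient-𝒪 j = ≼-respˡ-≈ (Γ.inverseʳ _)
        (≼-* (≼-iter-suc ε<γ (v≈fin⇒≼ vc) j) (v≈fin⇒≼ (v-inv c²≉0 (v-*-fin vc vc))))

    HenselFor : (DPoly → Set) → Set (k ⊔ ℓ ⊔ ℓΓ ⊔ ℓΓ′)
    HenselFor P = ∀ f a → P f → CoeffsIn𝒪 f → a ∈𝒪 →
      fin Γ.ε <∞ v (eval τ f a) → v (eval τ (deriv f) a) ≈∞ fin Γ.ε →
      Σ Carrier (λ b → b ∈𝒪 × eval τ f b ≈ 0# × (b - a) ∈ℳ)

    NewtonFor : (DPoly → Set) → Set (k ⊔ ℓ ⊔ ℓΓ ⊔ ℓΓ′)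
    NewtonFor P = ∀ f a δ → P f → CoeffsIn𝒪 f → a ∈𝒪 →
      v (eval τ (deriv f) a) ≈∞ fin δ → fin (δ Γ.∙ δ) <∞ v (eval τ f a) →
      Σ Carrier (λ b → b ∈𝒪 × eval τ f b ≈ 0# × v (a - b) ≈∞ (v (eval τ f a) ⊖ δ))

    module NewtonFromHensel (P : DPoly → Set)
      (P-nearIdentity : ∀ {a c d} τc≈c²d {f} u e → P f →
                        P (nearIdentity u e (Rescaling.remainder a c d τc≈c²d f)))
      (hensel : HenselFor P) where

      module NewtonStep (f : DPoly) (a : Carrier) (δ ν : Γ.Carrier) (Pf : P f) (hf : CoeffsIn𝒪 f)
                        (a𝒪 : a ∈𝒪) (vD : v (eval τ (deriv f) a) ≈∞ fin δ)
                        (vfa : v (eval τ f a) ≈∞ fin ν) (δ∙δ<ν : (δ Γ.∙ δ) Γ.< ν) where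
        γ : Γ.Carrier
        γ = ν Γ.∙ δ Γ.⁻¹
        δ<γ : δ Γ.< γ
        δ<γ = x∙y<z⇒x<z∙y⁻¹ δ∙δ<ν
        ε<γ : Γ.ε Γ.< γ
        ε<γ = ≤-<-trans (fin-≤⁻ (≤∞-respʳ-≈∞ vD (eval-deriv-𝒪 f hf a𝒪))) δ<γ
        c : Carrier
        c = proj₁ (v-onto γ)
        vc : v c ≈∞ fin γ
        vc = proj₂ (v-onto γ)
        c𝒪 : c ∈𝒪
        c𝒪 = v≈fin⇒∈𝒪 {c} (<⇒≤ ε<γ) vc
        open Rescaling a c (τ-quotient vc ε<γ) (τ-quotient-eq vc ε<γ)
        D : Carrier
        D = eval τ (deriv f) a
        D≉0 : ¬ (D ≈ 0#)
        D≉0 = v≈fin⇒≉0 vD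
        cD≉0 : ¬ (c * D ≈ 0#)
        cD≉0 = v≈fin⇒≉0 (v-*-fin vc vD)
        u : Carrier
        u = eval τ f a * inv (c * D) cD≉0
        vu : v u ≈∞ fin Γ.ε
        vu = ≈∞-trans (v-*-fin vfa (v-inv cD≉0 (v-*-fin vc vD)))
               (fin≈ (Γ.trans (Γ.∙-congˡ (Γ.⁻¹-cong (//-rightDividesˡ δ ν))) (Γ.inverseʳ ν)))
        -u𝒪 : (- u) ∈𝒪
        -u𝒪 = v≈fin⇒≼ (≈∞-trans (v-neg u) vu)
        e : Carrier
        e = c * inv D D≉0
        ve : v e ≈∞ fin (γ Γ.∙ δ Γ.⁻¹)
        ve = v-*-fin vc (v-inv D≉0 vD)
        ε<γ-δ : Γ.ε Γ.< (γ Γ.∙ δ Γ.⁻¹)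
        ε<γ-δ = x<y⇒ε<y∙x⁻¹ δ<γ
        R𝒪 : CoeffsIn𝒪 (remainder f)
        R𝒪 = remainder-𝒪 (τ-quotient-𝒪 vc ε<γ) a𝒪 c𝒪 f hf
        g : DPoly
        g = nearIdentity u e (remainder f)
        Pg : P g
        Pg = P-nearIdentity (τ-quotient-eq vc ε<γ) u e Pf
        g𝒪 : CoeffsIn𝒪 g
        g𝒪 = (v≈fin⇒≼ {x = u} vu , _) , (v≈fin⇒∈𝒪 {e} (<⇒≤ ε<γ-δ) ve , R𝒪)
        g[-u]∈ℳ : fin Γ.ε <∞ v (eval τ g (- u))
        g[-u]∈ℳ = proj₁ (nearIdentity-hensel {u} {e} (remainder f) R𝒪 vu ve ε<γ-δ)
        g′[-u]-unit : v (eval τ (deriv g) (- u)) ≈∞ fin Γ.ε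
        g′[-u]-unit = proj₂ (nearIdentity-hensel {u} {e} (remainder f) R𝒪 vu ve ε<γ-δ)
        root : Σ Carrier (λ y → y ∈𝒪 × eval τ g y ≈ 0# × (y - - u) ∈ℳ) →
               Σ Carrier (λ b → b ∈𝒪 × eval τ f b ≈ 0# × v (a - b) ≈∞ fin γ)
        root (y , y𝒪 , gy≈0 , y+u∈ℳ) =
          a + c * y ,
          𝒪-+ a𝒪 (𝒪-* c𝒪 y𝒪) ,
          (begin
            eval τ f (a + c * y)          ≈⟨ eval-rescaled-nearIdentity f y (x*[y*x⁻¹]≈y (c * D) (eval τ f a) cD≉0)
                                                 (x*[y*x⁻¹]≈y D c D≉0) ⟨
            (c * D) * eval τ g y          ≈⟨ *-congˡ gy≈0 ⟩
            (c * D) * 0#                  ≈⟨ zeroʳ _ ⟩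
            0#                            ∎) ,
          ≈∞-trans (v-cong (x-[x+y]≈-y a (c * y)))
            (≈∞-trans (v-neg _) (≈∞-trans (v-*-fin vc vy) (fin≈ (Γ.identityʳ γ))))
          where
          vy : v y ≈∞ fin Γ.ε
          vy = ≈∞-trans (v-cong (sym (x+[y-x]≈y (- u) y))) (v-+-dominant (≈∞-trans (v-neg u) vu) y+u∈ℳ)

        newton-step : Σ Carrier (λ b → b ∈𝒪 × eval τ f b ≈ 0# × v (a - b) ≈∞ fin γ)
        newton-step = root (hensel g (- u) Pg g𝒪 -u𝒪 g[-u]∈ℳ g′[-u]-unit)

      opaque
        newton-fin : ∀ f a δ ν → P f → CoeffsIn𝒪 f → a ∈𝒪 →
          v (eval τ (deriv f) a) ≈∞ fin δ → v (eval τ f a) ≈∞ fin ν → (δ Γ.∙ δ) Γ.< ν →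
          Σ Carrier (λ b → b ∈𝒪 × eval τ f b ≈ 0# × v (a - b) ≈∞ fin (ν Γ.∙ δ Γ.⁻¹))
        newton-fin f a δ ν Pf hf a𝒪 vD vfa δ∙δ<ν = NewtonStep.newton-step f a δ ν Pf hf a𝒪 vD vfa δ∙δ<ν

      newton : NewtonFor P
      newton f a δ Pf hf a𝒪 vD δ∙δ<vfa with valueView (eval τ f a)
      ... | infinite h = a , a𝒪 , v-∞⇒0 _ h , ≈∞-trans (x≈0⇒v≈∞ (-‿inverseʳ a)) (≈∞-sym (⊖-cong δ h))
      ... | finite ν h with newton-fin f a δ ν Pf hf a𝒪 vD h (fin-<⁻ (<∞-respʳ-≈∞ h δ∙δ<vfa))
      ...   | b , b𝒪 , fb≈0 , vab = b , b𝒪 , fb≈0 , ≈∞-trans vab (≈∞-sym (⊖-cong δ h))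

    hensel-from-newton : ∀ {P} → NewtonFor P → HenselFor P
    hensel-from-newton newton f a Pf hf a𝒪 fa∈ℳ f′a-unit
      with newton f a Γ.ε Pf hf a𝒪 f′a-unit (<∞-respˡ-≈∞ (fin≈ (Γ.sym (Γ.identityʳ Γ.ε))) fa∈ℳ)
    ... | b , b𝒪 , fb≈0 , vab =
      b , b𝒪 , fb≈0 , <∞-respʳ-≈∞ (≈∞-trans (≈∞-sym (x⊖ε≈x _)) (≈∞-trans (≈∞-sym vab) (v-sub-comm a b))) fa∈ℳ

    v-deriv-stable : ∀ f {a b δ γ} → CoeffsIn𝒪 f → a ∈𝒪 → b ∈𝒪 →
      v (eval τ (deriv f) a) ≈∞ fin δ → δ Γ.< γ → Γ.ε Γ.< γ → γ ≼ (b - a) →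
      v (eval τ (deriv f) b) ≈∞ fin δ
    v-deriv-stable f {a} {b} hf a𝒪 b𝒪 vD δ<γ ε<γ γ≼b-a
      with taylor₀ (deriv f) (deriv-𝒪 f hf) a𝒪 (𝒪-- b𝒪 a𝒪) γ≼b-a (λ j → ≼-iter ε<γ γ≼b-a (suc j))
    ... | r , γ≼r , f′b≈f′a+r =
      ≈∞-trans (v-cong (trans (sym (eval-cong (deriv f) (x+[y-x]≈y a b))) f′b≈f′a+r))
               (v-+-dominant vD (<∞-≤∞-trans (fin-< δ<γ) γ≼r))

    -- f(b′) - f(b) = f′(b)(b′ - b) + (terms of value ≥ 2 v(b′ - b)), and the first term dominates.
    root-isolated : ∀ f {b b′ δ} → CoeffsIn𝒪 f → b ∈𝒪 → b′ ∈𝒪 →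
      eval τ f b ≈ 0# → eval τ f b′ ≈ 0# → v (eval τ (deriv f) b) ≈∞ fin δ → Γ.ε Γ.≤ δ →
      fin δ <∞ v (b′ - b) → b ≈ b′
    root-isolated f {b} {b′} {δ} hf b𝒪 b′𝒪 fb≈0 fb′≈0 vD ε≤δ δ<v[b′-b] with valueView (b′ - b)
    ... | infinite h = sym (x∙y⁻¹≈ε⇒x≈y b′ b (v-∞⇒0 _ h))
    ... | finite μ h = ⊥-elim (v≈fin⇒≉0 v[f′b·e+r] f′b·e+r≈0)
      where
      e : Carrier
      e = b′ - b
      δ<μ : δ Γ.< μ
      δ<μ = fin-<⁻ (<∞-respʳ-≈∞ h δ<v[b′-b])
      ε<μ : Γ.ε Γ.< μ
      ε<μ = ≤-<-trans ε≤δ δ<μ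
      expansion : Σ Carrier (λ r → (μ Γ.∙ μ) ≼ r × eval τ f (b + e) ≈ eval τ f b + eval τ (deriv f) b * e + r)
      expansion = taylor₁ f hf b𝒪 (𝒪-- b′𝒪 b𝒪) (v≈fin⇒≼ (v-*-fin h h)) (≼-iter-suc ε<μ (v≈fin⇒≼ h))
      r : Carrier
      r = proj₁ expansion
      f′b·e+r≈0 : eval τ (deriv f) b * e + r ≈ 0#
      f′b·e+r≈0 = begin
        eval τ (deriv f) b * e + r                ≈⟨ +-congʳ (+-identityˡ _) ⟨
        0# + eval τ (deriv f) b * e + r           ≈⟨ +-congʳ (+-congʳ fb≈0) ⟨
        eval τ f b + eval τ (deriv f) b * e + r   ≈⟨ proj₂ (proj₂ expansion) ⟨
        eval τ f (b + e)                          ≈⟨ eval-cong f (x+[y-x]≈y b b′) ⟩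
        eval τ f b′                               ≈⟨ fb′≈0 ⟩
        0#                                        ∎
      v[f′b·e+r] : v (eval τ (deriv f) b * e + r) ≈∞ fin (δ Γ.∙ μ)
      v[f′b·e+r] = v-+-dominant (v-*-fin vD h)
        (<∞-≤∞-trans (fin-< (∙-mono-<-≤ δ<μ (≤-refl {μ}))) (proj₁ (proj₂ expansion)))

    newton-unique : ∀ f a δ b b′ → CoeffsIn𝒪 f → a ∈𝒪 →
      v (eval τ (deriv f) a) ≈∞ fin δ → fin (δ Γ.∙ δ) <∞ v (eval τ f a) →
      b ∈𝒪 → b′ ∈𝒪 → eval τ f b ≈ 0# → eval τ f b′ ≈ 0# →
      (v (eval τ f a) ⊖ δ) ≤∞ v (a - b) → (v (eval τ f a) ⊖ δ) ≤∞ v (a - b′) →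
      b ≈ b′
    newton-unique f a δ b b′ hf a𝒪 vD δ∙δ<vfa b𝒪 b′𝒪 fb≈0 fb′≈0 close close′ with valueView (eval τ f a)
    ... | infinite h = trans (sym (a≈ close)) (a≈ close′)
      where
      a≈ : ∀ {x} → (v (eval τ f a) ⊖ δ) ≤∞ v (a - x) → a ≈ x
      a≈ {x} cl = x∙y⁻¹≈ε⇒x≈y a x (v-∞⇒0 _ (∞≤⇒≈∞ (≤∞-respˡ-≈∞ (⊖-cong δ h) cl)))
    ... | finite ν h =
      root-isolated f hf b𝒪 b′𝒪 fb≈0 fb′≈0
        (v-deriv-stable f hf a𝒪 b𝒪 vD δ<γ ε<γ (≤∞-respʳ-≈∞ (v-sub-comm a b) γ≼a-b))
        ε≤δ (<∞-≤∞-trans (fin-< δ<γ) (≼-respʳ-≈ ([x-y]-[x-z]≈z-y a b b′) (≼-- γ≼a-b γ≼a-b′)))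
      where
      γ : Γ.Carrier
      γ = ν Γ.∙ δ Γ.⁻¹
      ε≤δ : Γ.ε Γ.≤ δ
      ε≤δ = fin-≤⁻ (≤∞-respʳ-≈∞ vD (eval-deriv-𝒪 f hf a𝒪))
      δ<γ : δ Γ.< γ
      δ<γ = x∙y<z⇒x<z∙y⁻¹ (fin-<⁻ (<∞-respʳ-≈∞ h δ∙δ<vfa))
      ε<γ : Γ.ε Γ.< γ
      ε<γ = ≤-<-trans ε≤δ δ<γ
      γ≼a-b : γ ≼ (a - b)
      γ≼a-b = ≤∞-respˡ-≈∞ (⊖-cong δ h) close
      γ≼a-b′ : γ ≼ (a - b′)
      γ≼a-b′ = ≤∞-respˡ-≈∞ (⊖-cong δ h) close′

-- Frobenius twists of a model of VFA

module FrobeniusTwists {k ℓ ℓΓ ℓΓ′} (p : ℕ) (K : ValuedField k ℓ ℓΓ ℓΓ′) (A : VFA p K) where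
  open ValuedField K hiding (zero)
  open VFA A
  open OrderedAbelianGroupProperties Γ
  open ExtendedValueProperties Γ
  open ValuedFieldProperties K
  open DifferencePolynomials K
  open import Relation.Binary.Reasoning.Setoid setoid

  p≡1+ : Σ ℕ (λ q → p ≡.≡ suc q)
  p≡1+ with charExp
  ... | inj₁ (p≡1 , _) = 0 , p≡1
  ... | inj₂ (pp , _)  = 1+ p (nonTrivial⇒n>1 p {{prime⇒nonTrivial pp}})
    where
    1+ : ∀ n → 1 ℕ.< n → Σ ℕ (λ q → n ≡.≡ suc q)
    1+ (suc n) _ = n , ≡.refl

  pⁿ≡1+ : ∀ n → Σ ℕ (λ q → p ℕ.^ n ≡.≡ suc q)
  pⁿ≡1+ n with p≡1+
  ... | q , ≡.refl = 1+qⁿ n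
    where
    1+qⁿ : ∀ n → Σ ℕ (λ r → suc q ℕ.^ n ≡.≡ suc r)
    1+qⁿ zero = 0 , ≡.refl
    1+qⁿ (suc n) with 1+qⁿ n
    ... | r , eq = r ℕ.+ q ℕ.* suc r , ≡.cong (suc q ℕ.*_) eq

  p·β≤β : ∀ {β} → β Γ.≤ Γ.ε → (p Γ.· β) Γ.≤ β
  p·β≤β β≤ε with p≡1+
  ... | q , eq rewrite eq = x≤ε⇒[1+n]·x≤x q β≤ε

  ^-cong : ∀ n {x y} → x ≈ y → x ^ n ≈ y ^ n
  ^-cong zero    e = refl
  ^-cong (suc n) e = *-cong e (^-cong n e)

  ^-distrib-* : ∀ n x y → (x * y) ^ n ≈ x ^ n * y ^ n
  ^-distrib-* zero    x y = sym (*-identityˡ 1#)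
  ^-distrib-* (suc n) x y = trans (*-congˡ (^-distrib-* n x y)) (*-interchange x y _ _)
    where open import Algebra.Properties.CommutativeSemigroup *-commutativeSemigroup
            using () renaming (interchange to *-interchange)

  1^n≈1 : ∀ n → 1# ^ n ≈ 1#
  1^n≈1 zero    = refl
  1^n≈1 (suc n) = trans (*-identityˡ _) (1^n≈1 n)

  v-^ : ∀ n {x α} → v x ≈∞ fin α → v (x ^ n) ≈∞ fin (n Γ.· α)
  v-^ zero    hx = v-1
  v-^ (suc n) hx = v-*-fin hx (v-^ n hx)

  𝒪-^ : ∀ n {x} → x ∈𝒪 → (x ^ n) ∈𝒪
  𝒪-^ zero    h = 𝒪-1
  𝒪-^ (suc n) h = 𝒪-* h (𝒪-^ n h)

  φ-+ : ∀ x y → φ (x + y) ≈ φ x + φ y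
  φ-+ x y with charExp
  ... | inj₁ (≡.refl , _) = trans (*-identityʳ _) (sym (+-cong (*-identityʳ x) (*-identityʳ y)))
  ... | inj₂ (pp , p≈0) = begin
    (x + y) ^ p                 ≈⟨ ^≈^ₛ (x + y) p ⟩
    (x + y) ^ₛ p                ≈⟨ frobenius-+ p×1≈0 x y ⟩
    x ^ₛ p + y ^ₛ p             ≈⟨ +-cong (^≈^ₛ x p) (^≈^ₛ y p) ⟨
    x ^ p + y ^ p               ∎
    where
    open ExpProperties semiring using () renaming (_^_ to _^ₛ_)
    open MultProperties semiring using () renaming (_×_ to _·_)
    open Frobenius K-ring pp
    ^≈^ₛ : ∀ x n → x ^ n ≈ x ^ₛ n
    ^≈^ₛ x zero    = refl
    ^≈^ₛ x (suc n) = *-congˡ (^≈^ₛ x n)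
    ι≡·1 : ∀ n → ι n ≡.≡ n · 1#
    ι≡·1 zero    = ≡.refl
    ι≡·1 (suc n) = ≡.cong (_+_ 1#) (ι≡·1 n)
    p×1≈0 : p · 1# ≈ 0#
    p×1≈0 = ≡.subst (_≈ 0#) (ι≡·1 p) p≈0

  φ-isEndomorphism : IsEndomorphism φ
  φ-isEndomorphism = record
    { cong = ^-cong p ; +-homo = φ-+ ; *-homo = ^-distrib-* p ; 1-homo = 1^n≈1 p ; 𝒪-homo = 𝒪-^ p }

  φ-injective : ∀ {x y} → φ x ≈ φ y → x ≈ y
  φ-injective {x} {y} φx≈φy = x∙y⁻¹≈ε⇒x≈y x y x-y≈0
    where
    open IsEndomorphism φ-isEndomorphism
    x-y≈0 : x - y ≈ 0#
    x-y≈0 with valueView (x - y)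
    ... | infinite h = v-∞⇒0 _ h
    ... | finite α h = ⊥-elim (v≈fin⇒≉0 (v-^ p h)
      (trans (+-homo x (- y)) (trans (+-congˡ (-‿homo y)) (trans (+-congʳ φx≈φy) (-‿inverseʳ _)))))

  φφ⁻¹x≈x : ∀ x → φ (φ⁻¹ x) ≈ x
  φφ⁻¹x≈x x = proj₂ (perfect x)

  φ⁻¹-isEndomorphism : IsEndomorphism φ⁻¹
  φ⁻¹-isEndomorphism = record
    { cong   = λ {x} {y} e → φ-injective (trans (φφ⁻¹x≈x x) (trans e (sym (φφ⁻¹x≈x y))))
    ; +-homo = λ x y → φ-injective (trans (φφ⁻¹x≈x (x + y)) (sym (trans (+-homo _ _) (+-cong (φφ⁻¹x≈x x) (φφ⁻¹x≈x y)))))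
    ; *-homo = λ x y → φ-injective (trans (φφ⁻¹x≈x (x * y)) (sym (trans (*-homo _ _) (*-cong (φφ⁻¹x≈x x) (φφ⁻¹x≈x y)))))
    ; 1-homo = φ-injective (trans (φφ⁻¹x≈x 1#) (sym 1-homo))
    ; 𝒪-homo = φ⁻¹-𝒪 }
    where
    open IsEndomorphism φ-isEndomorphism
    -- v(φ⁻¹ x) = β < 0 would give v x = p β ≤ β < 0.
    φ⁻¹-𝒪 : ∀ {x} → x ∈𝒪 → φ⁻¹ x ∈𝒪
    φ⁻¹-𝒪 {x} x∈𝒪 with valueView (φ⁻¹ x)
    ... | infinite h = ≤∞-respʳ-≈∞ (≈∞-sym h) ≤top
    ... | finite β h with total Γ.ε β
    ...   | inj₁ ε≤β = v≈fin⇒∈𝒪 ε≤β h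
    ...   | inj₂ β≤ε = v≈fin⇒∈𝒪 (≤-trans ε≤p·β (p·β≤β β≤ε)) h
      where
      ε≤p·β : Γ.ε Γ.≤ (p Γ.· β)
      ε≤p·β = fin-≤⁻ (≤∞-respʳ-≈∞ (≈∞-trans (v-cong (sym (φφ⁻¹x≈x x))) (v-^ p h)) x∈𝒪)

  φ^-isEndomorphism : ∀ m → IsEndomorphism (φ^ m)
  φ^-isEndomorphism (+ n)    = isEndomorphism-iter φ-isEndomorphism n
  φ^-isEndomorphism -[1+ n ] = isEndomorphism-iter φ⁻¹-isEndomorphism (suc n)

  v-φⁿ : ∀ n {x α} → v x ≈∞ fin α → v (iter φ n x) ≈∞ fin ((p ℕ.^ n) Γ.· α)
  v-φⁿ zero    {α = α} hx = ≈∞-trans hx (fin≈ (Γ.sym (Γ.identityʳ α)))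
  v-φⁿ (suc n) {α = α} hx = ≈∞-trans (v-^ p (v-φⁿ n hx)) (fin≈ (Γ.sym (·-homo-* p (p ℕ.^ n) α)))

  α≤pⁿ·α : ∀ n {α} → Γ.ε Γ.≤ α → α Γ.≤ ((p ℕ.^ n) Γ.· α)
  α≤pⁿ·α n ε≤α with pⁿ≡1+ n
  ... | q , eq rewrite eq = ε≤x⇒x≤[1+n]·x q ε≤α

  pⁿ·β≤β : ∀ n {β} → β Γ.≤ Γ.ε → ((p ℕ.^ n) Γ.· β) Γ.≤ β
  pⁿ·β≤β n β≤ε with pⁿ≡1+ n
  ... | q , eq rewrite eq = x≤ε⇒[1+n]·x≤x q β≤ε

  φⁿφ⁻ⁿx≈x : ∀ n x → iter φ n (iter φ⁻¹ n x) ≈ x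
  φⁿφ⁻ⁿx≈x zero    x = refl
  φⁿφ⁻ⁿx≈x (suc n) x = ≡.subst (_≈ x) (≡.sym (iter-suc φ n (φ⁻¹ (iter φ⁻¹ n x))))
    (trans (IsEndomorphism.cong (isEndomorphism-iter φ-isEndomorphism n) (φφ⁻¹x≈x _)) (φⁿφ⁻ⁿx≈x n x))

  σ-isEndomorphism : IsEndomorphism σ
  σ-isEndomorphism = record
    { cong = σ-cong ; +-homo = σ-+ ; *-homo = σ-* ; 1-homo = σ-1 ; 𝒪-homo = λ {x} → proj₁ (σ-𝒪 x) }

  σ-≼ : ∀ N {x β} → v x ≈∞ fin β → Γ.ε Γ.< β → ((N Γ.· β) Γ.∙ (N Γ.· β)) ≼ σ x
  σ-≼ N {x} {β} h ε<β =
    ≼-respˡ-≈ (Γ.trans (·-homo-* 2 N β) (2·x≈x∙x _)) (proj₁ (σ-growth x β (2 ℕ.* N) h ε<β))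

  twist-growth : ∀ m {x α} → v x ≈∞ fin α → Γ.ε Γ.< α → (α Γ.∙ α) ≼ twist m x
  twist-growth (+ n) {x} {α} h ε<α =
    ≤-≼-trans (∙-mono-≤ α≤β α≤β)
      (≼-respˡ-≈ (Γ.∙-cong (Γ.identityʳ β) (Γ.identityʳ β)) (σ-≼ 1 (v-φⁿ n h) (<-≤-trans ε<α α≤β)))
    where
    β : Γ.Carrier
    β = (p ℕ.^ n) Γ.· α
    α≤β : α Γ.≤ β
    α≤β = α≤pⁿ·α n (<⇒≤ ε<α)
  -- Here x = φⁿ⁺¹(w), so v x = pⁿ⁺¹ v w and 2 v x = (2 pⁿ⁺¹) v w < v (σ w).
  twist-growth -[1+ n ] {x} {α} h (ε≤α , ε≉α) with valueView (iter φ⁻¹ (suc n) x)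
  ... | infinite hw = ⊥-elim (IsEndomorphism.≉0-homo (φ^-isEndomorphism -[1+ n ]) (v≈fin⇒≉0 h) (v-∞⇒0 _ hw))
  ... | finite β hw = ≼-respˡ-≈ (Γ.∙-cong (Γ.sym α≈P·β) (Γ.sym α≈P·β)) (σ-≼ P hw ε<β)
    where
    P : ℕ
    P = p ℕ.^ suc n
    α≈P·β : α Γ.≈ (P Γ.· β)
    α≈P·β = fin-≈⁻ (≈∞-trans (≈∞-sym h) (≈∞-trans (v-cong (sym (φⁿφ⁻ⁿx≈x (suc n) x))) (v-φⁿ (suc n) hw)))
    ε<β : Γ.ε Γ.< β
    ε<β with total Γ.ε β
    ... | inj₁ ε≤β = ε≤β , λ ε≈β → ε≉α (Γ.sym (Γ.trans α≈P·β (Γ.trans (·-cong P (Γ.sym ε≈β)) (n·ε≈ε P))))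
    ... | inj₂ β≤ε = ⊥-elim (ε≉α (antisym ε≤α (≤-respˡ-≈ (Γ.sym α≈P·β) (≤-trans (pⁿ·β≤β (suc n) β≤ε) β≤ε))))

  twist-isIncreasing : ∀ m → IsIncreasingEndomorphism (twist m)
  twist-isIncreasing m = record
    { isEndomorphism = isEndomorphism-∘ σ-isEndomorphism (φ^-isEndomorphism m)
    ; growth         = twist-growth m }

  σ-isIncreasing : IsIncreasingEndomorphism σ
  σ-isIncreasing = twist-isIncreasing (+ 0)

  transformallyHenselian⇒newton : TransformallyHenselian → ∀ m → Newton (twist m)
  transformallyHenselian⇒newton henselian m f a δ = newton f a δ tt
    where
    open Transformal (twist-isIncreasing m)
    open NewtonFromHensel (λ _ → ⊤) (λ _ _ _ _ → tt) (λ f a _ → henselian m f a)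

  newton⇒transformallyHenselian : (∀ m → Newton (twist m)) → TransformallyHenselian
  newton⇒transformallyHenselian newtonₘ m f a =
    Transformal.hensel-from-newton (twist-isIncreasing m) (λ f a δ _ → newtonₘ m f a δ) f a tt

  twist-newtonUnique : ∀ m → NewtonUnique (twist m)
  twist-newtonUnique m = Transformal.newton-unique (twist-isIncreasing m)

-- Approximate roots under algebraic Henselianity

module ApproximateNewton {k ℓ ℓΓ ℓΓ′} (p : ℕ) (K : ValuedField k ℓ ℓΓ ℓΓ′) (A : VFA p K)
                         (algebraicallyHenselian : VFA.AlgebraicallyHenselian A) where
  open ValuedField K hiding (zero)
  open VFA A
  open OrderedAbelianGroupProperties Γ
  open ExtendedValueProperties Γ
  open ValuedFieldProperties K
  open DifferencePolynomials K
  open FrobeniusTwists p K A using (σ-isIncreasing)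
  open Transformal σ-isIncreasing

  algebraic-newton : NewtonFor Algebraic
  algebraic-newton = NewtonFromHensel.newton Algebraic
    (λ {a} {c} {d} τc≈c²d {f} u e af → (tt , ≡.refl) , (tt , Rescaling.remainder-algebraic a c d τc≈c²d f af))
    algebraicallyHenselian

  frozen-newton : ∀ f z δ → CoeffsIn𝒪 f → z ∈𝒪 →
    v (eval σ (deriv f) z) ≈∞ fin δ → fin (δ Γ.∙ δ) <∞ v (eval σ f z) →
    Σ Carrier (λ b → b ∈𝒪 × eval σ (freeze f z) b ≈ 0# × v (z - b) ≈∞ (v (eval σ f z) ⊖ δ))
  frozen-newton f z δ hf z𝒪 vD δ∙δ<vfz
    with algebraic-newton (freeze f z) z δ (freeze-algebraic f z) (freeze-𝒪 f hf z𝒪) z𝒪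
           (≈∞-trans (v-cong (eval-deriv-freeze f z)) vD)
           (<∞-≤∞-trans δ∙δ<vfz (≤∞-reflexive (v-cong (sym (eval-freeze f z)))))
  ... | b , b𝒪 , Fb≈0 , vzb = b , b𝒪 , Fb≈0 , ≈∞-trans vzb (⊖-cong δ (v-cong (eval-freeze f z)))

  frozen-root-≼ : ∀ f {z b β} → CoeffsIn𝒪 f → z ∈𝒪 → b ∈𝒪 → eval σ (freeze f z) b ≈ 0# →
                  Γ.ε Γ.< β → β ≼ σ (b - z) → β ≼ eval σ f b
  frozen-root-≼ f {z} {b} {β} hf z𝒪 b𝒪 Fb≈0 ε<β β≼σ[b-z]
    with eval-freeze-≼ f hf b𝒪 z𝒪 (λ j → ≡.subst (β ≼_) (≡.sym (iter-suc σ j (b - z))) (≼-iter ε<β β≼σ[b-z] j))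
  ... | r , β≼r , fb≈Fb+r = ≼-respʳ-≈ (sym (trans fb≈Fb+r (trans (+-congʳ Fb≈0) (+-identityˡ r)))) β≼r

  ≼-σ-factor : ∀ {c x s β} (c≉0 : ¬ (c ≈ 0#)) → v (σ c) ≈∞ fin s → β ≼ σ (x * inv c c≉0) → (s Γ.∙ β) ≼ σ x
  ≼-σ-factor {c} {x} c≉0 vσc h =
    ≼-respʳ-≈ (trans (sym (σ-* c _)) (σ-cong (x*[y*x⁻¹]≈y c x c≉0))) (≼-* (v≈fin⇒≼ vσc) h)

  module Approximation (f : DPoly) (a : Carrier) (δ ν : Γ.Carrier) (hf : CoeffsIn𝒪 f) (a𝒪 : a ∈𝒪)
                       (vD : v (eval σ (deriv f) a) ≈∞ fin δ) (vfa : v (eval σ f a) ≈∞ fin ν)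
                       (δ∙δ<ν : (δ Γ.∙ δ) Γ.< ν) where
    γ : Γ.Carrier
    γ = ν Γ.∙ δ Γ.⁻¹
    ε≤δ : Γ.ε Γ.≤ δ
    ε≤δ = fin-≤⁻ (≤∞-respʳ-≈∞ vD (eval-deriv-𝒪 f hf a𝒪))
    δ<γ : δ Γ.< γ
    δ<γ = x∙y<z⇒x<z∙y⁻¹ δ∙δ<ν
    ε<γ : Γ.ε Γ.< γ
    ε<γ = ≤-<-trans ε≤δ δ<γ
    ν≤γ∙γ : ν Γ.≤ (γ Γ.∙ γ)
    ν≤γ∙γ = ≤-respˡ-≈ (//-rightDividesˡ δ ν) (∙-monoʳ-≤ γ (<⇒≤ δ<γ))
    c₀ : Carrier
    c₀ = proj₁ (v-onto γ)
    vc₀ : v c₀ ≈∞ fin γ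
    vc₀ = proj₂ (v-onto γ)
    c₀≉0 : ¬ (c₀ ≈ 0#)
    c₀≉0 = v≈fin⇒≉0 vc₀

    module _ (s : Γ.Carrier) (vσc₀ : v (σ c₀) ≈∞ fin s) where
      n·γ<s : ∀ n → (n Γ.· γ) Γ.< s
      n·γ<s n = fin-<⁻ (<∞-respʳ-≈∞ vσc₀ (σ-growth c₀ γ n vc₀ ε<γ))
      ε<s : Γ.ε Γ.< s
      ε<s = n·γ<s 0
      γ∙γ<s : (γ Γ.∙ γ) Γ.< s
      γ∙γ<s = <-respˡ-≈ (2·x≈x∙x γ) (n·γ<s 2)
      γ∙γ∙γ<s : ((γ Γ.∙ γ) Γ.∙ γ) Γ.< s
      γ∙γ∙γ<s = <-respˡ-≈ (Γ.trans (Γ.∙-congˡ (2·x≈x∙x γ)) (Γ.sym (Γ.assoc γ γ γ))) (n·γ<s 3)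

      δ∙δ<s : (δ Γ.∙ δ) Γ.< s
      δ∙δ<s = ≤-<-trans (∙-mono-≤ (<⇒≤ δ<γ) (<⇒≤ δ<γ)) γ∙γ<s
      γ∙δ<s : (γ Γ.∙ δ) Γ.< s
      γ∙δ<s = ≤-<-trans (∙-monoʳ-≤ γ (<⇒≤ δ<γ)) γ∙γ<s
      γγ∙δ<s : ((γ Γ.∙ γ) Γ.∙ δ) Γ.< s
      γγ∙δ<s = ≤-<-trans (∙-monoʳ-≤ (γ Γ.∙ γ) (<⇒≤ δ<γ)) γ∙γ∙γ<s
      ε<ν∙s : Γ.ε Γ.< (ν Γ.∙ s)
      ε<ν∙s = <-respˡ-≈ (Γ.identityʳ Γ.ε)
        (∙-mono-≤-< (≤-trans (≤-respˡ-≈ (Γ.identityʳ Γ.ε) (∙-mono-≤ ε≤δ ε≤δ)) (<⇒≤ δ∙δ<ν)) ε<s)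

      first-approximation : Σ Carrier (λ b → b ∈𝒪 × eval σ (freeze f a) b ≈ 0# × v (a - b) ≈∞ fin γ)
      first-approximation with frozen-newton f a δ hf a𝒪 vD (<∞-respʳ-≈∞ (≈∞-sym vfa) (fin-< δ∙δ<ν))
      ... | b , b𝒪 , Fb≈0 , vab = b , b𝒪 , Fb≈0 , ≈∞-trans vab (⊖-cong δ vfa)

      -- A second Newton step, for f frozen at the first approximation b₁, moves b₁ by at least
      -- s − δ ≥ 2γ, so the σ-terms of f change by at least s + 2γ ≥ s + ν.
      module SecondStep (b₁ : Carrier) (b₁𝒪 : b₁ ∈𝒪) (F₁b₁≈0 : eval σ (freeze f a) b₁ ≈ 0#)
                        (vab₁ : v (a - b₁) ≈∞ fin γ) where
        γ≼b₁-a : γ ≼ (b₁ - a)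
        γ≼b₁-a = ≤∞-respʳ-≈∞ (v-sub-comm a b₁) (v≈fin⇒≼ vab₁)
        s≼fb₁ : s ≼ eval σ f b₁
        s≼fb₁ = frozen-root-≼ f hf a𝒪 b₁𝒪 F₁b₁≈0 ε<s
          (≼-respˡ-≈ (Γ.identityʳ s) (≼-σ-factor c₀≉0 vσc₀
            (proj₁ (σ-𝒪 _) (≼-*-inv c₀≉0 vc₀ (≼-respˡ-≈ (Γ.sym (Γ.identityʳ γ)) γ≼b₁-a)))))
        vD₁ : v (eval σ (deriv f) b₁) ≈∞ fin δ
        vD₁ = v-deriv-stable f hf a𝒪 b₁𝒪 vD δ<γ ε<γ γ≼b₁-a

        module _ (b₂ : Carrier) (b₂𝒪 : b₂ ∈𝒪) (F₂b₂≈0 : eval σ (freeze f b₁) b₂ ≈ 0#)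
                 (vb₁b₂ : v (b₁ - b₂) ≈∞ (v (eval σ f b₁) ⊖ δ)) where
          r≼b₁-b₂ : (s Γ.∙ δ Γ.⁻¹) ≼ (b₁ - b₂)
          r≼b₁-b₂ = ≤∞-respʳ-≈∞ (≈∞-sym vb₁b₂) (⊖-monoˡ-≤∞ δ s≼fb₁)
          vab₂ : v (a - b₂) ≈∞ fin γ
          vab₂ = ≈∞-trans (v-cong (sym ([x-y]+[y-z]≈x-z a b₁ b₂)))
            (v-+-dominant vab₁ (<∞-≤∞-trans (fin-< (x∙y<z⇒x<z∙y⁻¹ γ∙δ<s)) r≼b₁-b₂))
          γ∙γ≼b₂-b₁ : (γ Γ.∙ γ) ≼ (b₂ - b₁)
          γ∙γ≼b₂-b₁ = ≤-≼-trans (<⇒≤ (x∙y<z⇒x<z∙y⁻¹ γγ∙δ<s)) (≤∞-respʳ-≈∞ (v-sub-comm b₁ b₂) r≼b₁-b₂)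
          ν∙s≼σ[b₂-b₁] : (ν Γ.∙ s) ≼ σ (b₂ - b₁)
          ν∙s≼σ[b₂-b₁] = ≤-≼-trans (≤-respˡ-≈ (Γ.comm s ν) (∙-monoʳ-≤ s ν≤γ∙γ))
            (≼-σ-factor c₀≉0 vσc₀ (≼-growth ε<γ (≼-*-inv c₀≉0 vc₀ γ∙γ≼b₂-b₁)))
          ν∙s≼fb₂ : (ν Γ.∙ s) ≼ eval σ f b₂
          ν∙s≼fb₂ = frozen-root-≼ f hf b₁𝒪 b₂𝒪 F₂b₂≈0 ε<ν∙s ν∙s≼σ[b₂-b₁]

        second-approximation : Σ Carrier (λ b → b ∈𝒪 × (ν Γ.∙ s) ≼ eval σ f b × v (a - b) ≈∞ fin γ)
        second-approximation = improve (frozen-newton f b₁ δ hf b₁𝒪 vD₁ (<∞-≤∞-trans (fin-< δ∙δ<s) s≼fb₁))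
          where
          improve : Σ Carrier (λ b → b ∈𝒪 × eval σ (freeze f b₁) b ≈ 0# × v (b₁ - b) ≈∞ (v (eval σ f b₁) ⊖ δ)) →
                    Σ Carrier (λ b → b ∈𝒪 × (ν Γ.∙ s) ≼ eval σ f b × v (a - b) ≈∞ fin γ)
          improve (b₂ , b₂𝒪 , F₂b₂≈0 , vb₁b₂) =
            b₂ , b₂𝒪 , ν∙s≼fb₂ b₂ b₂𝒪 F₂b₂≈0 vb₁b₂ , vab₂ b₂ b₂𝒪 F₂b₂≈0 vb₁b₂

    approximate-root : Σ Carrier (λ b → b ∈𝒪 × (fin ν +∞ v (σ c₀)) ≤∞ v (eval σ f b) × v (a - b) ≈∞ fin γ)
    approximate-root with valueView (σ c₀)
    ... | infinite h = ⊥-elim (IsIncreasingEndomorphism.≉0-homo σ-isIncreasing c₀≉0 (v-∞⇒0 _ h))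
    ... | finite s vσc₀ = conclude (refine (first-approximation s vσc₀))
      where
      refine : Σ Carrier (λ b → b ∈𝒪 × eval σ (freeze f a) b ≈ 0# × v (a - b) ≈∞ fin γ) →
               Σ Carrier (λ b → b ∈𝒪 × (ν Γ.∙ s) ≼ eval σ f b × v (a - b) ≈∞ fin γ)
      refine (b₁ , b₁𝒪 , F₁b₁≈0 , vab₁) = SecondStep.second-approximation s vσc₀ b₁ b₁𝒪 F₁b₁≈0 vab₁
      conclude : Σ Carrier (λ b → b ∈𝒪 × (ν Γ.∙ s) ≼ eval σ f b × v (a - b) ≈∞ fin γ) →
                 Σ Carrier (λ b → b ∈𝒪 × (fin ν +∞ v (σ c₀)) ≤∞ v (eval σ f b) × v (a - b) ≈∞ fin γ)
      conclude (b , b𝒪 , ν∙s≼fb , vab) = b , b𝒪 , ≤∞-respˡ-≈∞ (+∞-cong ≈∞-refl (≈∞-sym vσc₀)) ν∙s≼fb , vab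

  algebraicallyHenselian⇒approxNewton : ApproxNewton
  algebraicallyHenselian⇒approxNewton f a δ hf a𝒪 vD δ∙δ<vfa with v (eval σ f a) in eq
  ... | ∞     = a , a𝒪 , ≡.subst (∞ ≤∞_) (≡.sym eq) ≤top , x≈0⇒v≈∞ (-‿inverseʳ a)
  ... | fin ν = Approximation.approximate-root f a δ ν hf a𝒪 vD
                  (≡.subst (_≈∞ fin ν) (≡.sym eq) ≈∞-refl) (fin-<⁻ δ∙δ<vfa)

mainTheorem20 : ∀ {c ℓ g ℓg} (p : ℕ) (K : ValuedField c ℓ g ℓg) (A : VFA p K) →
    ((VFA.TransformallyHenselian A → ∀ m → VFA.Newton A (VFA.twist A m))
     × ((∀ m → VFA.Newton A (VFA.twist A m)) → VFA.TransformallyHenselian A))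
    × ((∀ m → VFA.Newton A (VFA.twist A m)) → ∀ m → VFA.NewtonUnique A (VFA.twist A m))
    × (VFA.AlgebraicallyHenselian A → VFA.ApproxNewton A)
mainTheorem20 p K A =
  (transformallyHenselian⇒newton , newton⇒transformallyHenselian) ,
  -- Uniqueness holds in every twist outright.
  (λ _ → twist-newtonUnique) ,
  ApproximateNewton.algebraicallyHenselian⇒approxNewton p K A
  where open FrobeniusTwists p K A
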